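{- For $k\ge1$ let $f_k(z;213)=\sum_{n\ge 1} a_{n,k}(213)z^n$, where $a_{n,k}(213)$ is the number of cyclic permutations $\pi\in\mathfrak S_n$ whose one-line notation avoids $\delta_k=k(k-1)\cdots 21$ and whose cycle form $C(\pi)$ avoids $213$. Then for $k\ge 4$, \[f_k(z;213)=\frac{z}{1-f_{k-1}(z;213)},\] with $f_1(z;213)=0$, $f_2(z;213)=z$, and $f_3(z;213)=\frac{z(1-z)}{1-2z}$.
   Context: A permutation $\pi\in\mathfrak S_n$ is cyclic if it is a single $n$-cycle. Its cycle form is $C(\pi)=(1,c_2,\dots,c_n)$ with $c_2=\pi(1)$, $c_{i+1}=\pi(c_i)$; $C(\pi)$ avoids a pattern if the sequence $1,c_2,\dots,c_n$ does. A sequence avoids $\sigma\in\mathfrak S_m$ if no length-$m$ subsequence is order-isomorphic to $\sigma$. One-line notation: $\pi_1\cdots\pi_n$ with $\pi_i=\pi(i)$. -}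

module Defs where

open import Data.Nat using (ℕ; zero; suc; _∸_; _<ᵇ_; _≡ᵇ_)
open import Data.Bool using (Bool; true; false; _∧_; _∨_; not; if_then_else_)
open import Data.Bool.Properties using () renaming (_≟_ to _≟ᵇ_)
open import Data.List using (List; []; _∷_; map; concatMap; filter; length; upTo; downFrom; foldr)
open import Data.Bool.ListAction using (all; any)
open import Data.Integer as ℤ using (ℤ; +_)
open import Relation.Binary.PropositionalEquality using (_≡_)

insertions : ℕ → List ℕ → List (List ℕ)
insertions x []       = (x ∷ []) ∷ []
insertions x (y ∷ ys) = (x ∷ y ∷ ys) ∷ map (y ∷_) (insertions x ys)

perms : ℕ → List (List ℕ)
perms zero    = [] ∷ []
perms (suc n) = concatMap (insertions (suc n)) (perms n)

nth : List ℕ → ℕ → ℕ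
nth []       _       = 0
nth (x ∷ xs) zero    = x
nth (x ∷ xs) (suc i) = nth xs i

-- π(i) for a permutation π in one-line notation, i ∈ {1,…,n}
app : List ℕ → ℕ → ℕ
app π i = nth π (i ∸ 1)

-- cycle form C(π) = (1, c₂, …, cₙ), c₂ = π(1), c_{i+1} = π(cᵢ)
iterateFrom : List ℕ → ℕ → ℕ → List ℕ
iterateFrom π c zero    = []
iterateFrom π c (suc m) = c ∷ iterateFrom π (app π c) m

cycleForm : List ℕ → List ℕ
cycleForm π = iterateFrom π 1 (length π)

elemᵇ : ℕ → List ℕ → Bool
elemᵇ x = any (x ≡ᵇ_)

distinctᵇ : List ℕ → Bool
distinctᵇ []       = true
distinctᵇ (x ∷ xs) = not (elemᵇ x xs) ∧ distinctᵇ xs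

-- π is cyclic (a single n-cycle): the orbit 1, π(1), …, π^{n-1}(1)
-- consists of n distinct elements
isCyclic : List ℕ → Bool
isCyclic π = distinctᵇ (cycleForm π)

subseqs : ℕ → List ℕ → List (List ℕ)
subseqs zero    _        = [] ∷ []
subseqs (suc m) []       = []
subseqs (suc m) (x ∷ xs) = map (x ∷_) (subseqs m xs) Data.List.++ subseqs (suc m) xs

orderIso : List ℕ → List ℕ → Bool
orderIso a b =
  (length a ≡ᵇ length b) ∧
  all (λ i → all (λ j → eqB (nth a i <ᵇ nth a j) (nth b i <ᵇ nth b j))
                 (upTo (length a)))
      (upTo (length a))
  where
  eqB : Bool → Bool → Bool
  eqB x y = (x ∧ y) ∨ (not x ∧ not y)

containsᵇ : List ℕ → List ℕ → Bool
containsᵇ σ s = any (λ t → orderIso t σ) (subseqs (length σ) s)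

avoidsᵇ : List ℕ → List ℕ → Bool
avoidsᵇ σ s = not (containsᵇ σ s)

δ : ℕ → List ℕ
δ k = map suc (downFrom k)

p213 : List ℕ
p213 = 2 ∷ 1 ∷ 3 ∷ []

a : ℕ → ℕ → ℕ
a n k = length (filter (λ π → isCyclic π ∧ avoidsᵇ (δ k) π ∧ avoidsᵇ p213 (cycleForm π) ≟ᵇ true)
                       (perms n))

FPS : Set
FPS = ℕ → ℤ

_≈_ : FPS → FPS → Set
F ≈ G = ∀ n → F n ≡ G n

_⊛_ : FPS → FPS → FPS
(F ⊛ G) n = foldr ℤ._+_ (+ 0) (map (λ i → F i ℤ.* G (n ∸ i)) (upTo (suc n)))

_⊕_ : FPS → FPS → FPS
(F ⊕ G) n = F n ℤ.+ G n

_⊖_ : FPS → FPS → FPS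
(F ⊖ G) n = F n ℤ.- G n

mono : ℤ → ℕ → FPS
mono c m n = if m ≡ᵇ n then c else + 0

𝟘 : FPS
𝟘 _ = + 0

𝟙 : FPS
𝟙 = mono (+ 1) 0

Z : FPS
Z = mono (+ 1) 1

f : ℕ → FPS
f k zero    = + 0
f k (suc n) = + a (suc n) k

{-# OPTIONS --safe #-}
module Submission where

-- Cut the cycle form C = (1, c, …) of a counted permutation at c = α + 1. Avoiding 213 forces
-- C = 1, α + 1, B, T with B > α + 1 > T, so C glues two smaller 213-avoiding cycle words: (1 T) on
-- 1, …, α and (1, B − α). In one-line notation the glued permutation is α + 1, τ(2), …, τ(α), followed
-- by σ shifted up by α with its entry 1 replaced by τ(1). A decreasing subsequence either stays in the
-- σ-block or starts in the τ-block and then meets the σ-block only in τ(1). So avoiding δ_k factors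
-- through four related words (π, headToEnd π, delete 1 π, headToEnd∖1 π), whose generating functions
-- L, D, M, E satisfy
--   L = [k>1] z + D L,    D = [k>2] z + D M_{k-2},    E = [k>2] z + E M_{k-2},
--   M = [k>0] z + [k>1] z M + (E - [k>2] z) L.
-- Equations X = C + X Y with Y(0) = 0 have unique solutions. Hence E = D and M = L for k ≥ 3, then
-- D_k = M_{k-1} = L_{k-1} for k ≥ 4, and so L_k = z + L_{k-1} L_k.

open import Defs
open import Data.Nat using (ℕ; zero; suc; _+_; _*_; _∸_; _≤_; _<_; _>_; z≤n; s≤s; _<ᵇ_; _≡ᵇ_; _≟_; _<?_)
open import Data.Nat.Properties
open import Algebra.Properties.CommutativeSemigroup +-commutativeSemigroup using () renaming (interchange to +-interchange)
open import Data.Nat.Induction using (<-rec)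
open import Data.Integer as ℤ using (ℤ; +_; _-_)
import Data.Integer.Properties as ℤP
open import Data.Integer.Tactic.RingSolver using (solve-∀)
open import Data.Bool using (Bool; true; false; _∧_; _∨_; not; if_then_else_; T)
open import Data.Bool.Properties using (∧-comm; ∧-conicalˡ; ∧-conicalʳ; T-≡) renaming (_≟_ to _≟ᵇ_)
open import Data.Bool.ListAction using (all; any)
open import Data.List using (List; []; _∷_; [_]; map; length; _++_; downFrom; take; drop; filter; concatMap; foldr; applyUpTo)
open import Data.Nat.ListAction using (sum)
open import Data.List.Properties
  using (length-map; length-++; length-take; length-downFrom; ++-assoc; ++-identityʳ; ++-cancelʳ;
         map-++; map-∘; map-id; map-cong-local; map-injective; ∷-injectiveˡ; ∷-injectiveʳ;
         filter-++; filter-all; filter-accept; filter-reject; filter-notAll)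
open import Data.List.Membership.Propositional using (_∈_; _∉_; find)
open import Data.List.Membership.Propositional.Properties
  using (∈-++⁻; ∈-++⁺ˡ; ∈-++⁺ʳ; ∈-map⁺; ∈-map⁻; ∈-upTo⁺; ∈-upTo⁻; ∈-filter⁺; ∈-filter⁻;
         ∈-concat⁻′; ∈-concat⁺′; ∈-insert; ∈-∃++)
open import Data.List.Membership.DecPropositional _≟_ using (_∈?_)
open import Data.List.Relation.Unary.Any as Any using (Any; here; there)
import Data.List.Relation.Unary.Any.Properties as Any
open import Data.List.Relation.Unary.All as All using (All; []; _∷_)
import Data.List.Relation.Unary.All.Properties as All
open import Data.List.Relation.Unary.AllPairs as AllPairs using (AllPairs; []; _∷_)
import Data.List.Relation.Unary.AllPairs.Properties as AllPairs
open import Data.List.Relation.Unary.Unique.Propositional using (Unique)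
import Data.List.Relation.Unary.Unique.Propositional.Properties as Unique
open import Data.List.Relation.Binary.Sublist.Propositional using (_⊆_; []; _∷_; _∷ʳ_; ⊆-refl; ⊆-trans; minimum; from∈; lookup)
open import Data.List.Relation.Binary.Sublist.Propositional.Properties
  using (++⁺; ++⁺ˡ; ++⁺ʳ; map⁺; All-resp-⊆; length-mono-≤; filter-⊆; filter⁺; take-⊆)
open import Data.Product using (_×_; _,_; proj₁; proj₂; ∃-syntax)
open import Data.Sum using (_⊎_; inj₁; inj₂)
import Data.Sum
open import Data.Sum.Function.Propositional using (_⊎-⇔_)
open import Data.Empty using (⊥-elim)
open import Data.Unit using (tt)
open import Function using (id; _∘_; _⇔_; mk⇔; Equivalence)
import Function.Properties.Equivalence as ⇔
open import Function.Related.Propositional using (module EquationalReasoning; equivalence)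
open import Relation.Nullary using (¬_; Dec; yes; no; ¬?; contradiction)
open import Relation.Binary.Bundles using (Setoid)
open import Relation.Binary.Definitions using (tri<; tri≈; tri>)
open import Relation.Binary.PropositionalEquality using (_≡_; _≢_; refl; sym; trans; cong; cong₂; subst; module ≡-Reasoning)

⊆-++-split : ∀ (xs ys : List ℕ) {u} → u ⊆ xs ++ ys → ∃[ u₁ ] ∃[ u₂ ] (u ≡ u₁ ++ u₂ × u₁ ⊆ xs × u₂ ⊆ ys)
⊆-++-split [] ys p = [] , _ , refl , [] , p
⊆-++-split (x ∷ xs) ys (.x ∷ʳ p) with u₁ , u₂ , refl , p₁ , p₂ ← ⊆-++-split xs ys p =
  u₁ , u₂ , refl , x ∷ʳ p₁ , p₂
⊆-++-split (x ∷ xs) ys (refl ∷ p) with u₁ , u₂ , refl , p₁ , p₂ ← ⊆-++-split xs ys p =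
  x ∷ u₁ , u₂ , refl , refl ∷ p₁ , p₂

⊆-map⁻ : ∀ (f : ℕ → ℕ) s {u} → u ⊆ map f s → ∃[ v ] (v ⊆ s × u ≡ map f v)
⊆-map⁻ f [] [] = [] , [] , refl
⊆-map⁻ f (x ∷ s) (._ ∷ʳ p) with v , q , refl ← ⊆-map⁻ f s p = v , x ∷ʳ q , refl
⊆-map⁻ f (x ∷ s) (refl ∷ p) with v , q , refl ← ⊆-map⁻ f s p = x ∷ v , refl ∷ q , refl

AllPairs-resp-⊆ : ∀ {R : ℕ → ℕ → Set} {u s} → u ⊆ s → AllPairs R s → AllPairs R u
AllPairs-resp-⊆ [] ps = ps
AllPairs-resp-⊆ (_ ∷ʳ p) (_ ∷ ps) = AllPairs-resp-⊆ p ps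
AllPairs-resp-⊆ (refl ∷ p) (a ∷ ps) = All-resp-⊆ p a ∷ AllPairs-resp-⊆ p ps

AllPairs-++⁻ : ∀ {R : ℕ → ℕ → Set} u₁ {u₂} → AllPairs R (u₁ ++ u₂) →
               AllPairs R u₁ × AllPairs R u₂ × All (λ x → All (R x) u₂) u₁
AllPairs-++⁻ [] ps = [] , ps , []
AllPairs-++⁻ (x ∷ u₁) (a ∷ ps) with p₁ , p₂ , p₁₂ ← AllPairs-++⁻ u₁ ps =
  All.++⁻ˡ u₁ a ∷ p₁ , p₂ , All.++⁻ʳ u₁ a ∷ p₁₂

∈⇒length≥1 : ∀ {x} {xs : List ℕ} → x ∈ xs → 1 ≤ length xs
∈⇒length≥1 (here _) = s≤s z≤n
∈⇒length≥1 (there _) = s≤s z≤n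

private
  remove : ∀ {A : Set} {x : A} ys → x ∈ ys →
           ∃[ zs ] (suc (length zs) ≡ length ys × (∀ {y} → y ∈ ys → y ≢ x → y ∈ zs))
  remove (y ∷ ys) (here refl) = ys , refl , λ { (here refl) y≢y → contradiction refl y≢y ; (there y∈) _ → y∈ }
  remove (y ∷ ys) (there x∈) with zs , l , sub ← remove ys x∈ =
    y ∷ zs , cong suc l , λ { (here refl) _ → here refl ; (there y∈) y≢x → there (sub y∈ y≢x) }

Unique-⊆⇒length-≤ : ∀ {A : Set} {xs ys : List A} → Unique xs → (∀ {x} → x ∈ xs → x ∈ ys) → length xs ≤ length ys
Unique-⊆⇒length-≤ {xs = []} _ _ = z≤n
Unique-⊆⇒length-≤ {xs = x ∷ xs} (x∉xs ∷ u) xs⊆ys with zs , l , sub ← remove _ (xs⊆ys (here refl)) =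
  subst (suc (length xs) ≤_) l
        (s≤s (Unique-⊆⇒length-≤ u λ y∈ → sub (xs⊆ys (there y∈)) λ { refl → All.lookup x∉xs y∈ refl }))

Unique-≐⇒length-≡ : ∀ {A : Set} {xs ys : List A} → Unique xs → Unique ys →
                    (∀ {x} → x ∈ xs → x ∈ ys) → (∀ {x} → x ∈ ys → x ∈ xs) → length xs ≡ length ys
Unique-≐⇒length-≡ u v xs⊆ys ys⊆xs = ≤-antisym (Unique-⊆⇒length-≤ u xs⊆ys) (Unique-⊆⇒length-≤ v ys⊆xs)

Unique-map⁺ : ∀ {A B : Set} (f : A → B) {xs} → (∀ {x y} → x ∈ xs → y ∈ xs → f x ≡ f y → x ≡ y) →
              Unique xs → Unique (map f xs)
Unique-map⁺ f {[]} _ [] = []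
Unique-map⁺ f {x ∷ xs} inj (x∉ ∷ u) =
  All.tabulate (λ fy∈ fx≡fy → let y , y∈ , e = ∈-map⁻ f fy∈ in
                               All.lookup x∉ y∈ (inj (here refl) (there y∈) (trans fx≡fy e)))
  ∷ Unique-map⁺ f (λ x∈ y∈ → inj (there x∈) (there y∈)) u

∈-concatMap⁻ : ∀ {A B : Set} (g : A → List B) L {π} → π ∈ concatMap g L → ∃[ ρ ] (ρ ∈ L × π ∈ g ρ)
∈-concatMap⁻ g L π∈ with _ , π∈xs , xs∈ ← ∈-concat⁻′ (map g L) π∈ with ρ , ρ∈ , refl ← ∈-map⁻ g xs∈ =
  ρ , ρ∈ , π∈xs

∈-concatMap⁺ : ∀ {A B : Set} (g : A → List B) {L π ρ} → ρ ∈ L → π ∈ g ρ → π ∈ concatMap g L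
∈-concatMap⁺ g ρ∈ π∈ = ∈-concat⁺′ π∈ (∈-map⁺ g ρ∈)

Unique-concatMap⁺ : ∀ {A B : Set} (g : A → List B) {L} → Unique L → (∀ {ρ} → ρ ∈ L → Unique (g ρ)) →
                    (∀ {ρ ρ′ π} → ρ ∈ L → ρ′ ∈ L → π ∈ g ρ → π ∈ g ρ′ → ρ ≡ ρ′) → Unique (concatMap g L)
Unique-concatMap⁺ g {[]} _ _ _ = []
Unique-concatMap⁺ g {ρ ∷ L} (ρ∉ ∷ u) ug det =
  Unique.++⁺ (ug (here refl)) (Unique-concatMap⁺ g u (ug ∘ there) (λ ρ∈ ρ′∈ → det (there ρ∈) (there ρ′∈)))
    λ (π∈ , π∈′) → let ρ′ , ρ′∈ , π∈ρ′ = ∈-concatMap⁻ g L π∈′ in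
                   All.lookup ρ∉ ρ′∈ (det (here refl) (there ρ′∈) π∈ π∈ρ′)

≡ᵇ⇒≡-true : ∀ {m n} → (m ≡ᵇ n) ≡ true → m ≡ n
≡ᵇ⇒≡-true {m} {n} e = ≡ᵇ⇒≡ m n (subst T (sym e) tt)

≡⇒≡ᵇ-true : ∀ {m n} → m ≡ n → (m ≡ᵇ n) ≡ true
≡⇒≡ᵇ-true {zero} refl = refl
≡⇒≡ᵇ-true {suc m} refl = ≡⇒≡ᵇ-true {m} refl

≢⇒≡ᵇ-false : ∀ {m n} → m ≢ n → (m ≡ᵇ n) ≡ false
≢⇒≡ᵇ-false {m} {n} m≢n with m ≡ᵇ n in e
... | false = refl
... | true = ⊥-elim (m≢n (≡ᵇ⇒≡-true e))

≡ᵇ-false⇒≢ : ∀ {m n} → (m ≡ᵇ n) ≡ false → m ≢ n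
≡ᵇ-false⇒≢ {m} e refl with () ← trans (sym e) (≡⇒≡ᵇ-true {m} refl)

<ᵇ⇒<-true : ∀ {m n} → (m <ᵇ n) ≡ true → m < n
<ᵇ⇒<-true {m} {n} e = <ᵇ⇒< m n (subst T (sym e) tt)

<⇒<ᵇ-true : ∀ {m n} → m < n → (m <ᵇ n) ≡ true
<⇒<ᵇ-true {m} {n} p with m <ᵇ n | <⇒<ᵇ p
... | true | _ = refl

≮⇒<ᵇ-false : ∀ {m n} → ¬ m < n → (m <ᵇ n) ≡ false
≮⇒<ᵇ-false {m} {n} p with m <ᵇ n in e
... | false = refl
... | true = ⊥-elim (p (<ᵇ⇒<-true e))

OrderIso : List ℕ → List ℕ → Set
OrderIso a b = ∀ i j → i < length a → j < length a → (nth a i <ᵇ nth a j) ≡ (nth b i <ᵇ nth b j)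

subseqs-sound : ∀ m s {t} → t ∈ subseqs m s → t ⊆ s × length t ≡ m
subseqs-sound zero s (here refl) = minimum s , refl
subseqs-sound (suc m) (x ∷ xs) t∈ with ∈-++⁻ (map (x ∷_) (subseqs m xs)) t∈
... | inj₁ t∈ˡ with t' , t'∈ , refl ← ∈-map⁻ (x ∷_) t∈ˡ
  with p , l ← subseqs-sound m xs t'∈ = refl ∷ p , cong suc l
... | inj₂ t∈ʳ with p , l ← subseqs-sound (suc m) xs t∈ʳ = x ∷ʳ p , l

subseqs-complete : ∀ {s t} → t ⊆ s → t ∈ subseqs (length t) s
subseqs-complete [] = here refl
subseqs-complete {t = []} (y ∷ʳ p) = here refl
subseqs-complete {t = t ∷ ts} (y ∷ʳ p) = ∈-++⁺ʳ (map (y ∷_) (subseqs (length ts) _)) (subseqs-complete p)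
subseqs-complete (refl ∷ p) = ∈-++⁺ˡ (∈-map⁺ (_ ∷_) (subseqs-complete p))

private
  sameᵇ : Bool → Bool → Bool
  sameᵇ x y = (x ∧ y) ∨ (not x ∧ not y)

  sameᵇ⇒≡ : ∀ x y → sameᵇ x y ≡ true → x ≡ y
  sameᵇ⇒≡ true true _ = refl
  sameᵇ⇒≡ false false _ = refl

  sameᵇ-refl : ∀ x → sameᵇ x x ≡ true
  sameᵇ-refl true = refl
  sameᵇ-refl false = refl

  all-true⁻ : ∀ {A : Set} (p : A → Bool) xs → all p xs ≡ true → ∀ {x} → x ∈ xs → p x ≡ true
  all-true⁻ p xs e x∈ = Equivalence.to T-≡ (All.lookup (All.all⁺ p xs (Equivalence.from T-≡ e)) x∈)

  all-true⁺ : ∀ {A : Set} (p : A → Bool) xs → (∀ {x} → x ∈ xs → p x ≡ true) → all p xs ≡ true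
  all-true⁺ p xs h = Equivalence.to T-≡ (All.all⁻ p (All.tabulate (Equivalence.from T-≡ ∘ h)))

  any-true⁻ : ∀ {A : Set} (p : A → Bool) xs → any p xs ≡ true → ∃[ x ] (x ∈ xs × p x ≡ true)
  any-true⁻ p xs e with x , x∈ , px ← find (Any.any⁻ p xs (Equivalence.from T-≡ e)) = x , x∈ , Equivalence.to T-≡ px

  any-true⁺ : ∀ {A : Set} (p : A → Bool) {xs x} → x ∈ xs → p x ≡ true → any p xs ≡ true
  any-true⁺ p x∈ px = Equivalence.to T-≡ (Any.any⁺ p (Any.map (λ { refl → Equivalence.from T-≡ px }) x∈))

orderIso-sound : ∀ a b → orderIso a b ≡ true → length a ≡ length b × OrderIso a b
orderIso-sound a b e =
  ≡ᵇ⇒≡-true (∧-conicalˡ _ _ e) , λ i j i< j< →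
    sameᵇ⇒≡ _ _ (all-true⁻ _ _ (all-true⁻ _ _ (∧-conicalʳ (length a ≡ᵇ length b) _ e) (∈-upTo⁺ i<)) (∈-upTo⁺ j<))

orderIso-complete : ∀ a b → length a ≡ length b → OrderIso a b → orderIso a b ≡ true
orderIso-complete a b l iso rewrite ≡⇒≡ᵇ-true l =
  all-true⁺ _ _ λ {i} i∈ → all-true⁺ _ _ λ {j} j∈ →
    subst (λ v → sameᵇ (nth a i <ᵇ nth a j) v ≡ true) (iso i j (∈-upTo⁻ i∈) (∈-upTo⁻ j∈))
          (sameᵇ-refl (nth a i <ᵇ nth a j))

contains-sound : ∀ σ s → containsᵇ σ s ≡ true → ∃[ t ] (t ⊆ s × length t ≡ length σ × OrderIso t σ)
contains-sound σ s e with t , t∈ , iso ← any-true⁻ _ _ e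
  with p , l ← subseqs-sound (length σ) s t∈ = t , p , l , proj₂ (orderIso-sound t σ iso)

contains-complete : ∀ σ s t → t ⊆ s → length t ≡ length σ → OrderIso t σ → containsᵇ σ s ≡ true
contains-complete σ s t p l iso =
  any-true⁺ (λ t → orderIso t σ) (subst (λ m → t ∈ subseqs m s) l (subseqs-complete p)) (orderIso-complete t σ l iso)

-- Decreasing subsequences

Decreasing : List ℕ → Set
Decreasing = AllPairs _>_

record HasDecreasing (k : ℕ) (s : List ℕ) : Set where
  constructor ⟨_,_,_,_⟩
  field
    sub : List ℕ
    sub⊆ : sub ⊆ s
    length-sub : length sub ≡ k
    decreasing : Decreasing sub

Antitone : ℕ → (ℕ → ℕ) → Set
Antitone n f = ∀ {i j} → i < n → j < n → j < i → f i < f j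

<ᵇ-antitone : ∀ {n f i j} → Antitone n f → i < n → j < n → (f i <ᵇ f j) ≡ (j <ᵇ i)
<ᵇ-antitone {f = f} {i} {j} anti i<n j<n with <-cmp i j
... | tri< i<j _ _ = trans (≮⇒<ᵇ-false (<⇒≯ (anti j<n i<n i<j))) (sym (≮⇒<ᵇ-false (<⇒≯ i<j)))
... | tri≈ _ refl _ = trans (≮⇒<ᵇ-false (n≮n (f i))) (sym (≮⇒<ᵇ-false (n≮n i)))
... | tri> _ _ j<i = trans (<⇒<ᵇ-true (anti i<n j<n j<i)) (sym (<⇒<ᵇ-true j<i))

All-nth : ∀ {P : ℕ → Set} xs → All P xs → ∀ {i} → i < length xs → P (nth xs i)
All-nth (x ∷ xs) (p ∷ ps) {zero} _ = p
All-nth (x ∷ xs) (p ∷ ps) {suc i} (s≤s i<) = All-nth xs ps i<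

nth-All : ∀ {P : ℕ → Set} xs → (∀ {i} → i < length xs → P (nth xs i)) → All P xs
nth-All [] h = []
nth-All (x ∷ xs) h = h (s≤s z≤n) ∷ nth-All xs (h ∘ s≤s)

Decreasing⇒Antitone : ∀ {t} → Decreasing t → Antitone (length t) (nth t)
Decreasing⇒Antitone {x ∷ xs} (a ∷ d) {suc i} {zero} (s≤s i<) _ _ = All-nth xs a i<
Decreasing⇒Antitone (a ∷ d) {suc i} {suc j} (s≤s i<) (s≤s j<) (s≤s j<i) = Decreasing⇒Antitone d i< j< j<i

<ᵇ-antitone⇒Decreasing : ∀ t → (∀ {i j} → i < length t → j < length t → (nth t i <ᵇ nth t j) ≡ (j <ᵇ i)) →
                         Decreasing t
<ᵇ-antitone⇒Decreasing [] h = []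
<ᵇ-antitone⇒Decreasing (x ∷ xs) h =
  nth-All xs (λ i< → <ᵇ⇒<-true (h (s≤s i<) (s≤s z≤n))) ∷ <ᵇ-antitone⇒Decreasing xs (λ i< j< → h (s≤s i<) (s≤s j<))

nth-δ : ∀ k {i} → i < k → nth (δ k) i ≡ k ∸ i
nth-δ (suc k) {zero} _ = refl
nth-δ (suc k) {suc i} (s≤s i<) = nth-δ k i<

δ-antitone : ∀ k → Antitone k (nth (δ k))
δ-antitone k {i} {j} i<k j<k j<i rewrite nth-δ k i<k | nth-δ k j<k = ∸-monoʳ-< j<i (<⇒≤ i<k)

length-δ : ∀ k → length (δ k) ≡ k
length-δ k = trans (length-map suc (downFrom k)) (length-downFrom k)

OrderIso-δ⇔Decreasing : ∀ {t k} → length t ≡ k → OrderIso t (δ k) ⇔ Decreasing t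
OrderIso-δ⇔Decreasing {t} {k} refl = mk⇔
  (λ iso → <ᵇ-antitone⇒Decreasing t λ i< j< → trans (iso _ _ i< j<) (<ᵇ-antitone (δ-antitone k) i< j<))
  (λ d _ _ i< j< → trans (<ᵇ-antitone (Decreasing⇒Antitone d) i< j<) (sym (<ᵇ-antitone (δ-antitone k) i< j<)))

containsδ⇔HasDecreasing : ∀ k s → containsᵇ (δ k) s ≡ true ⇔ HasDecreasing k s
containsδ⇔HasDecreasing k s = mk⇔ sound complete
  where
  sound : containsᵇ (δ k) s ≡ true → HasDecreasing k s
  sound e with t , t⊆ , l , iso ← contains-sound (δ k) s e =
    let l′ = trans l (length-δ k) in ⟨ t , t⊆ , l′ , Equivalence.to (OrderIso-δ⇔Decreasing l′) iso ⟩
  complete : HasDecreasing k s → containsᵇ (δ k) s ≡ true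
  complete ⟨ t , t⊆ , l , d ⟩ =
    contains-complete (δ k) s t t⊆ (trans l (sym (length-δ k))) (Equivalence.from (OrderIso-δ⇔Decreasing l) d)

avoidsδ : ℕ → List ℕ → Bool
avoidsδ k = avoidsᵇ (δ k)

private
  not≡false⇔≡true : ∀ {b} → not b ≡ false ⇔ b ≡ true
  not≡false⇔≡true {true} = mk⇔ (λ _ → refl) (λ _ → refl)
  not≡false⇔≡true {false} = mk⇔ (λ ()) (λ ())

  ≡∧-fromFalse : ∀ {b b₁ b₂} → b ≡ false ⇔ (b₁ ≡ false ⊎ b₂ ≡ false) → b ≡ b₁ ∧ b₂
  ≡∧-fromFalse {true} {true} {true} h = refl
  ≡∧-fromFalse {false} {true} {true} h with Equivalence.to h refl
  ... | inj₁ ()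
  ... | inj₂ ()
  ≡∧-fromFalse {_} {false} {_} h = Equivalence.from h (inj₁ refl)
  ≡∧-fromFalse {_} {true} {false} h = Equivalence.from h (inj₂ refl)

avoidsδ≡false⇔HasDecreasing : ∀ k s → avoidsδ k s ≡ false ⇔ HasDecreasing k s
avoidsδ≡false⇔HasDecreasing k s = ⇔.trans not≡false⇔≡true (containsδ⇔HasDecreasing k s)

HasDecreasing⇒¬avoidsδ : ∀ {k s} → HasDecreasing k s → avoidsδ k s ≡ false
HasDecreasing⇒¬avoidsδ = Equivalence.from (avoidsδ≡false⇔HasDecreasing _ _)

¬HasDecreasing⇒avoidsδ : ∀ {k s} → ¬ HasDecreasing k s → avoidsδ k s ≡ true
¬HasDecreasing⇒avoidsδ {k} {s} ¬d with avoidsδ k s in e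
... | true = refl
... | false = ⊥-elim (¬d (Equivalence.to (avoidsδ≡false⇔HasDecreasing k s) e))

avoidsδ-∧ : ∀ {k s k₁ s₁ k₂ s₂} →
            HasDecreasing k s ⇔ (HasDecreasing k₁ s₁ ⊎ HasDecreasing k₂ s₂) →
            avoidsδ k s ≡ avoidsδ k₁ s₁ ∧ avoidsδ k₂ s₂
avoidsδ-∧ {k} {s} {k₁} {s₁} {k₂} {s₂} h = ≡∧-fromFalse (mk⇔
  (λ e → Data.Sum.map HasDecreasing⇒¬avoidsδ HasDecreasing⇒¬avoidsδ (Equivalence.to h (to k s e)))
  (λ { (inj₁ e) → HasDecreasing⇒¬avoidsδ (Equivalence.from h (inj₁ (to k₁ s₁ e)))
     ; (inj₂ e) → HasDecreasing⇒¬avoidsδ (Equivalence.from h (inj₂ (to k₂ s₂ e))) }))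
  where
  to : ∀ k s → avoidsδ k s ≡ false → HasDecreasing k s
  to k s = Equivalence.to (avoidsδ≡false⇔HasDecreasing k s)

Has213 : List ℕ → Set
Has213 s = ∃[ x ] ∃[ y ] ∃[ z ] (x ∷ y ∷ z ∷ [] ⊆ s × y < x × x < z)

contains213⇔Has213 : ∀ s → containsᵇ p213 s ≡ true ⇔ Has213 s
contains213⇔Has213 s = mk⇔ sound complete
  where
  sound : containsᵇ p213 s ≡ true → Has213 s
  sound e with x ∷ y ∷ z ∷ [] , t⊆ , _ , iso ← contains-sound p213 s e =
    x , y , z , t⊆ , <ᵇ⇒<-true (iso 1 0 (s≤s (s≤s z≤n)) (s≤s z≤n)) ,
                     <ᵇ⇒<-true (iso 0 2 (s≤s z≤n) (s≤s (s≤s (s≤s z≤n))))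
  complete : Has213 s → containsᵇ p213 s ≡ true
  complete (x , y , z , t⊆ , y<x , x<z) = contains-complete p213 s _ t⊆ refl iso
    where
    iso : OrderIso (x ∷ y ∷ z ∷ []) p213
    iso 0 0 _ _ = ≮⇒<ᵇ-false (n≮n x)
    iso 0 1 _ _ = ≮⇒<ᵇ-false (<⇒≯ y<x)
    iso 0 2 _ _ = <⇒<ᵇ-true x<z
    iso 1 0 _ _ = <⇒<ᵇ-true y<x
    iso 1 1 _ _ = ≮⇒<ᵇ-false (n≮n y)
    iso 1 2 _ _ = <⇒<ᵇ-true (<-trans y<x x<z)
    iso 2 0 _ _ = ≮⇒<ᵇ-false (<⇒≯ x<z)
    iso 2 1 _ _ = ≮⇒<ᵇ-false (<⇒≯ (<-trans y<x x<z))
    iso 2 2 _ _ = ≮⇒<ᵇ-false (n≮n z)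
    iso (suc (suc (suc i))) j (s≤s (s≤s (s≤s ()))) _
    iso i (suc (suc (suc j))) _ (s≤s (s≤s (s≤s ())))

avoids213⇔¬Has213 : ∀ s → avoidsᵇ p213 s ≡ true ⇔ (¬ Has213 s)
avoids213⇔¬Has213 s with containsᵇ p213 s in e
... | true = mk⇔ (λ ()) (λ ¬h → contradiction (Equivalence.to (contains213⇔Has213 s) e) ¬h)
... | false = mk⇔ (λ _ h → contradiction (trans (sym e) (Equivalence.from (contains213⇔Has213 s) h)) λ ()) (λ _ → refl)

Has213-resp-⊆ : ∀ {s s′} → s ⊆ s′ → Has213 s → Has213 s′
Has213-resp-⊆ s⊆ (x , y , z , t⊆ , y<x , x<z) = x , y , z , ⊆-trans t⊆ s⊆ , y<x , x<z

Has213-shift : ∀ a s → Has213 (map (_+_ a) s) ⇔ Has213 s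
Has213-shift a s = mk⇔ to from
  where
  to : Has213 (map (_+_ a) s) → Has213 s
  to (_ , _ , _ , t⊆ , y<x , x<z) with x ∷ y ∷ z ∷ [] , t⊆′ , refl ← ⊆-map⁻ (_+_ a) s t⊆ =
    x , y , z , t⊆′ , +-cancelˡ-< a y x y<x , +-cancelˡ-< a x z x<z
  from : Has213 s → Has213 (map (_+_ a) s)
  from (x , y , z , t⊆ , y<x , x<z) = a + x , a + y , a + z , map⁺ (_+_ a) t⊆ , +-monoʳ-< a y<x , +-monoʳ-< a x<z

delete : ℕ → List ℕ → List ℕ
delete t = filter (λ y → ¬? (y ≟ t))

delete-⊆ : ∀ t Y → delete t Y ⊆ Y
delete-⊆ t = filter-⊆ (λ y → ¬? (y ≟ t))

delete⁺ : ∀ t {u Y} → u ⊆ Y → delete t u ⊆ delete t Y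
delete⁺ t = filter⁺ (λ y → ¬? (y ≟ t)) (λ y → ¬? (y ≟ t)) (λ { refl y≢t → y≢t })

delete-here : ∀ t ys → delete t (t ∷ ys) ≡ delete t ys
delete-here t ys = filter-reject (λ y → ¬? (y ≟ t)) (λ t≢t → t≢t refl)

delete-there : ∀ t {y} ys → y ≢ t → delete t (y ∷ ys) ≡ y ∷ delete t ys
delete-there t ys = filter-accept (λ y → ¬? (y ≟ t))

delete-fresh : ∀ t {u} → All (_≢ t) u → delete t u ≡ u
delete-fresh t = filter-all (λ y → ¬? (y ≟ t))

∈-delete⁻ : ∀ t Y {y} → y ∈ delete t Y → y ∈ Y × y ≢ t
∈-delete⁻ t Y = ∈-filter⁻ (λ y → ¬? (y ≟ t))

∈-delete⁺ : ∀ t Y {y} → y ∈ Y → y ≢ t → y ∈ delete t Y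
∈-delete⁺ t Y = ∈-filter⁺ (λ y → ¬? (y ≟ t))

length-delete-Decreasing : ∀ t {u} → Decreasing u → length u ≤ suc (length (delete t u))
length-delete-Decreasing t [] = z≤n
length-delete-Decreasing t {x ∷ u} (x>u ∷ d) with x ≟ t
... | yes refl rewrite delete-here x u | delete-fresh x (All.map <⇒≢ x>u) = ≤-refl
... | no x≢t rewrite delete-there t u x≢t = s≤s (length-delete-Decreasing t d)

HasDecreasing-zero : ∀ s → HasDecreasing 0 s
HasDecreasing-zero s = ⟨ [] , minimum s , refl , [] ⟩

HasDecreasing-resp-⊆ : ∀ {k s s′} → s ⊆ s′ → HasDecreasing k s → HasDecreasing k s′
HasDecreasing-resp-⊆ s⊆ ⟨ t , t⊆ , l , d ⟩ = ⟨ t , ⊆-trans t⊆ s⊆ , l , d ⟩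

HasDecreasing-≤ : ∀ {j k s} → j ≤ k → HasDecreasing k s → HasDecreasing j s
HasDecreasing-≤ {j} j≤k ⟨ t , t⊆ , refl , d ⟩ =
  ⟨ take j t , ⊆-trans (take-⊆ j t) t⊆ , trans (length-take j t) (m≤n⇒m⊓n≡m j≤k) , AllPairs.take⁺ j d ⟩

HasDecreasing-≤1 : ∀ {k} x s → k ≤ 1 → HasDecreasing k (x ∷ s)
HasDecreasing-≤1 x s k≤1 = HasDecreasing-≤ k≤1 ⟨ [ x ] , refl ∷ minimum s , refl , [] ∷ [] ⟩

HasDecreasing⇒≤length : ∀ {k s} → HasDecreasing k s → k ≤ length s
HasDecreasing⇒≤length ⟨ t , t⊆ , refl , _ ⟩ = length-mono-≤ t⊆

HasDecreasing-[_] : ∀ x {k} → HasDecreasing k [ x ] ⇔ k ≤ 1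
HasDecreasing-[ x ] = mk⇔ HasDecreasing⇒≤length (HasDecreasing-≤1 x [])

Decreasing-≡⇒⊆[_] : ∀ t {u} → Decreasing u → All (_≡ t) u → u ⊆ [ t ]
Decreasing-≡⇒⊆[ t ] [] [] = minimum _
Decreasing-≡⇒⊆[ t ] (_ ∷ []) (refl ∷ []) = ⊆-refl
Decreasing-≡⇒⊆[ t ] ((y<x ∷ _) ∷ _) (refl ∷ refl ∷ _) = ⊥-elim (<-irrefl refl y<x)

-- Every entry of Y except t lies above X, so a decreasing subsequence that meets X uses at most t from Y.
HasDecreasing-++ : ∀ X Y t {k} → t ∈ Y → (∀ {x y} → x ∈ X → y ∈ Y → y ≢ t → x < y) →
                   HasDecreasing k (X ++ Y) ⇔ (HasDecreasing k Y ⊎ HasDecreasing k (X ++ [ t ]))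
HasDecreasing-++ X Y t t∈Y X<Y = mk⇔ to from
  where
  to : ∀ {k} → HasDecreasing k (X ++ Y) → HasDecreasing k Y ⊎ HasDecreasing k (X ++ [ t ])
  to ⟨ u , u⊆ , l , d ⟩ with ⊆-++-split X Y u⊆
  ... | [] , u₂ , refl , _ , u₂⊆ = inj₁ ⟨ u₂ , u₂⊆ , l , d ⟩
  ... | x ∷ u₁ , u₂ , refl , u₁⊆ , u₂⊆ with _ , d₂ , x>u₂ ∷ _ ← AllPairs-++⁻ (x ∷ u₁) d =
    inj₂ ⟨ _ , ++⁺ u₁⊆ (Decreasing-≡⇒⊆[ t ] d₂ (All.tabulate only-t)) , l , d ⟩
    where
    only-t : ∀ {y} → y ∈ u₂ → y ≡ t
    only-t {y} y∈ with y ≟ t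
    ... | yes y≡t = y≡t
    ... | no y≢t = ⊥-elim (<-asym (All.lookup x>u₂ y∈) (X<Y (lookup u₁⊆ (here refl)) (lookup u₂⊆ y∈) y≢t))
  from : ∀ {k} → HasDecreasing k Y ⊎ HasDecreasing k (X ++ [ t ]) → HasDecreasing k (X ++ Y)
  from (inj₁ h) = HasDecreasing-resp-⊆ (++⁺ˡ X ⊆-refl) h
  from (inj₂ h) = HasDecreasing-resp-⊆ (++⁺ ⊆-refl (from∈ t∈Y)) h

HasDecreasing-∷-max : ∀ N s {k} → All (_< N) s → HasDecreasing (suc k) (N ∷ s) ⇔ HasDecreasing k s
HasDecreasing-∷-max N s N>s = mk⇔ to from
  where
  to : ∀ {k} → HasDecreasing (suc k) (N ∷ s) → HasDecreasing k s
  to ⟨ u , _ ∷ʳ u⊆ , l , d ⟩ = HasDecreasing-≤ (n≤1+n _) ⟨ u , u⊆ , l , d ⟩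
  to ⟨ _ ∷ u , refl ∷ u⊆ , l , _ ∷ d ⟩ = ⟨ u , u⊆ , suc-injective l , d ⟩
  from : ∀ {k} → HasDecreasing k s → HasDecreasing (suc k) (N ∷ s)
  from ⟨ u , u⊆ , l , d ⟩ = ⟨ N ∷ u , refl ∷ u⊆ , cong suc l , All-resp-⊆ u⊆ N>s ∷ d ⟩

HasDecreasing-∷-min : ∀ m s {k} → All (m <_) s → HasDecreasing k (m ∷ s) ⇔ (HasDecreasing k s ⊎ k ≤ 1)
HasDecreasing-∷-min m s m<s = mk⇔ to from
  where
  to : ∀ {k} → HasDecreasing k (m ∷ s) → HasDecreasing k s ⊎ k ≤ 1
  to ⟨ u , _ ∷ʳ u⊆ , l , d ⟩ = inj₁ ⟨ u , u⊆ , l , d ⟩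
  to ⟨ _ ∷ [] , refl ∷ _ , refl , _ ⟩ = inj₂ ≤-refl
  to ⟨ _ ∷ w ∷ _ , refl ∷ u⊆ , _ , (w<m ∷ _) ∷ _ ⟩ = ⊥-elim (<-asym w<m (All.lookup m<s (lookup u⊆ (here refl))))
  from : ∀ {k} → HasDecreasing k s ⊎ k ≤ 1 → HasDecreasing k (m ∷ s)
  from (inj₁ h) = HasDecreasing-resp-⊆ (m ∷ʳ ⊆-refl) h
  from (inj₂ k≤1) = HasDecreasing-≤1 m s k≤1

-- Every entry of Y except t lies above m > t, so a decreasing subsequence ending in m may use all of Y but t.
HasDecreasing-∷ʳ : ∀ Y m t {j} → t < m → (∀ {y} → y ∈ Y → y ≢ t → m < y) →
                   HasDecreasing (suc j) (Y ++ [ m ]) ⇔ HasDecreasing j (delete t Y)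
HasDecreasing-∷ʳ Y m t t<m m<Y = mk⇔ to from
  where
  to : ∀ {j} → HasDecreasing (suc j) (Y ++ [ m ]) → HasDecreasing j (delete t Y)
  to ⟨ u , u⊆ , l , d ⟩ with ⊆-++-split Y [ m ] u⊆
  ... | u₁ , [] , refl , u₁⊆ , _ ∷ʳ [] rewrite ++-identityʳ u₁ =
    HasDecreasing-≤ (≤-pred (subst (_≤ suc (length (delete t u₁))) l (length-delete-Decreasing t d)))
      ⟨ delete t u₁ , delete⁺ t u₁⊆ , refl , AllPairs-resp-⊆ (delete-⊆ t u₁) d ⟩
  ... | u₁ , _ ∷ [] , refl , u₁⊆ , refl ∷ [] with d₁ , _ , u₁>m ← AllPairs-++⁻ u₁ d =
    ⟨ u₁ , subst (_⊆ delete t Y) (delete-fresh t (All.map ≢t u₁>m)) (delete⁺ t u₁⊆) ,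
      suc-injective (trans (sym (trans (length-++ u₁) (+-comm (length u₁) 1))) l) , d₁ ⟩
    where
    ≢t : ∀ {x} → All (x >_) [ m ] → x ≢ t
    ≢t (m<x ∷ []) refl = <-asym t<m m<x
  from : ∀ {j} → HasDecreasing j (delete t Y) → HasDecreasing (suc j) (Y ++ [ m ])
  from ⟨ u , u⊆ , l , d ⟩ =
    ⟨ u ++ [ m ] , ++⁺ (⊆-trans u⊆ (delete-⊆ t Y)) ⊆-refl ,
      trans (length-++ u) (trans (+-comm (length u) 1) (cong suc l)) ,
      AllPairs.++⁺ d ([] ∷ []) (All.tabulate λ x∈ → let x∈Y , x≢t = ∈-delete⁻ t Y (lookup u⊆ x∈) in
                                                     m<Y x∈Y x≢t ∷ []) ⟩

IncreasingOn : List ℕ → (ℕ → ℕ) → Set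
IncreasingOn s f = ∀ {x y} → x ∈ s → y ∈ s → x < y → f x < f y

IncreasingOn-resp-⊆ : ∀ {f u s} → u ⊆ s → IncreasingOn s f → IncreasingOn u f
IncreasingOn-resp-⊆ u⊆ inc x∈ y∈ = inc (lookup u⊆ x∈) (lookup u⊆ y∈)

IncreasingOn-reflects : ∀ {f s} → IncreasingOn s f → ∀ {x y} → x ∈ s → y ∈ s → f x < f y → x < y
IncreasingOn-reflects {f} inc {x} {y} x∈ y∈ fx<fy with <-cmp x y
... | tri< x<y _ _ = x<y
... | tri≈ _ refl _ = ⊥-elim (<-irrefl refl fx<fy)
... | tri> _ _ y<x = ⊥-elim (<-asym fx<fy (inc y∈ x∈ y<x))

Decreasing-map : ∀ f {v} → IncreasingOn v f → Decreasing (map f v) ⇔ Decreasing v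
Decreasing-map f inc = mk⇔ (to inc) (from inc)
  where
  to : ∀ {v} → IncreasingOn v f → Decreasing (map f v) → Decreasing v
  to {[]} _ [] = []
  to {x ∷ v} inc (fx>fv ∷ d) =
    All.tabulate (λ y∈ → IncreasingOn-reflects inc (there y∈) (here refl) (All.lookup fx>fv (∈-map⁺ f y∈)))
    ∷ to (IncreasingOn-resp-⊆ (x ∷ʳ ⊆-refl) inc) d
  from : ∀ {v} → IncreasingOn v f → Decreasing v → Decreasing (map f v)
  from {[]} _ [] = []
  from {x ∷ v} inc (x>v ∷ d) =
    All.tabulate (λ fy∈ → let y , y∈ , e = ∈-map⁻ f fy∈ in
                          subst (_< f x) (sym e) (inc (there y∈) (here refl) (All.lookup x>v y∈)))
    ∷ from (IncreasingOn-resp-⊆ (x ∷ʳ ⊆-refl) inc) d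

HasDecreasing-map : ∀ f s {k} → IncreasingOn s f → HasDecreasing k (map f s) ⇔ HasDecreasing k s
HasDecreasing-map f s inc = mk⇔ to from
  where
  to : ∀ {k} → HasDecreasing k (map f s) → HasDecreasing k s
  to ⟨ u , u⊆ , l , d ⟩ with v , v⊆ , refl ← ⊆-map⁻ f s u⊆ =
    ⟨ v , v⊆ , trans (sym (length-map f v)) l , Equivalence.to (Decreasing-map f (IncreasingOn-resp-⊆ v⊆ inc)) d ⟩
  from : ∀ {k} → HasDecreasing k s → HasDecreasing k (map f s)
  from ⟨ v , v⊆ , l , d ⟩ =
    ⟨ map f v , map⁺ f v⊆ , trans (length-map f v) l , Equivalence.from (Decreasing-map f (IncreasingOn-resp-⊆ v⊆ inc)) d ⟩

-- One-line words of glued cycles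

relabel : ℕ → ℕ → ℕ → ℕ
relabel h a 1 = h
relabel h a x = a + x

relabel-≢1 : ∀ h a {x} → x ≢ 1 → relabel h a x ≡ a + x
relabel-≢1 h a {zero} _ = refl
relabel-≢1 h a {suc zero} x≢1 = ⊥-elim (x≢1 refl)
relabel-≢1 h a {suc (suc x)} _ = refl

-- The one-line form of the glued cycle (1 T)·(1 S), given the one-line forms h ∷ r of (1 T) and σ of (1 S)
-- (see oneLine-glue): 1 ↦ α + 1, the images of 2, …, α are kept, and σ is shifted by α except that 1 ↦ h.
glueOneLine : List ℕ → List ℕ → List ℕ
glueOneLine [] σ = σ
glueOneLine (h ∷ r) σ = suc (suc (length r)) ∷ r ++ map (relabel h (suc (length r))) σ

-- A decreasing subsequence of glueOneLine τ σ that starts in the τ-block can only continue with the entry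
-- h = τ(1) of the σ-block; so it lives in headToEnd τ, whose new top entry stands for the first glued entry.
headToEnd : List ℕ → List ℕ
headToEnd [] = []
headToEnd (x ∷ π) = suc (suc (length π)) ∷ π ++ [ x ]

headToEnd∖1 : List ℕ → List ℕ
headToEnd∖1 [] = []
headToEnd∖1 (x ∷ π) = suc (suc (length π)) ∷ delete 1 π ++ [ x ]

module Relabel {h a : ℕ} (h≤a : h ≤ a) where

  φ : ℕ → ℕ
  φ = relabel h a

  φ-above : ∀ {x} → 1 ≤ x → x ≢ 1 → suc a < φ x
  φ-above {x} x≥1 x≢1 rewrite relabel-≢1 h a x≢1 =
    subst (_< a + x) (+-comm a 1) (+-monoʳ-< a (≤∧≢⇒< x≥1 (x≢1 ∘ sym)))

  φ-increasing : ∀ {s} → All (1 ≤_) s → IncreasingOn s φ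
  φ-increasing s≥1 {x} {y} x∈ y∈ x<y with x ≟ 1 | y ≟ 1
  ... | _ | yes refl = ⊥-elim (<-irrefl refl (≤-trans x<y (All.lookup s≥1 x∈)))
  ... | yes refl | no y≢1 = <-trans (s≤s h≤a) (φ-above (All.lookup s≥1 y∈) y≢1)
  ... | no x≢1 | no y≢1 rewrite relabel-≢1 h a x≢1 | relabel-≢1 h a y≢1 = +-monoʳ-< a x<y

  φ-above-h : ∀ {s y} → All (1 ≤_) s → y ∈ map φ s → y ≢ h → suc a < y
  φ-above-h s≥1 y∈ y≢h with ∈-map⁻ φ y∈
  ... | x , x∈ , refl with x ≟ 1
  ...   | yes refl = ⊥-elim (y≢h refl)
  ...   | no x≢1 = φ-above (All.lookup s≥1 x∈) x≢1

  delete-φ : ∀ {s} → All (1 ≤_) s → delete h (map φ s) ≡ map φ (delete 1 s)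
  delete-φ [] = refl
  delete-φ {x ∷ s} (x≥1 ∷ s≥1) with x ≟ 1
  ... | yes refl rewrite delete-here h (map φ s) | delete-here 1 s = delete-φ s≥1
  ... | no x≢1 rewrite delete-there h (map φ s) (>⇒≢ (≤-trans (s≤s h≤a) (<⇒≤ (φ-above x≥1 x≢1))))
                     | delete-there 1 s x≢1 = cong (φ x ∷_) (delete-φ s≥1)

  module Blocks {σ : List ℕ} (σ≥1 : All (1 ≤_) σ) (1∈σ : 1 ∈ σ) (r : List ℕ) (r≤a : All (_≤ a) r) where
    open EquationalReasoning {k = equivalence}

    h∈φσ : h ∈ map φ σ
    h∈φσ = ∈-map⁺ φ 1∈σ

    HasDecreasing-left : ∀ {k} → HasDecreasing k (suc a ∷ r ++ map φ σ) ⇔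
                                 (HasDecreasing k σ ⊎ HasDecreasing k (suc a ∷ r ++ [ h ]))
    HasDecreasing-left {k} = begin
      HasDecreasing k (suc a ∷ r ++ map φ σ)
        ∼⟨ HasDecreasing-++ (suc a ∷ r) (map φ σ) h h∈φσ below ⟩
      (HasDecreasing k (map φ σ) ⊎ HasDecreasing k (suc a ∷ r ++ [ h ]))
        ∼⟨ HasDecreasing-map φ σ (φ-increasing σ≥1) ⊎-⇔ ⇔.refl ⟩
      (HasDecreasing k σ ⊎ HasDecreasing k (suc a ∷ r ++ [ h ])) ∎
      where
      below : ∀ {x y} → x ∈ suc a ∷ r → y ∈ map φ σ → y ≢ h → x < y
      below (here refl) y∈ y≢h = φ-above-h σ≥1 y∈ y≢h
      below (there x∈) y∈ y≢h = <-trans (s≤s (All.lookup r≤a x∈)) (φ-above-h σ≥1 y∈ y≢h)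

    HasDecreasing-right : ∀ {N k} → All (_< N) ((r ++ map φ σ) ++ [ suc a ]) →
                          HasDecreasing k (N ∷ (r ++ map φ σ) ++ [ suc a ]) ⇔
                          (HasDecreasing (k ∸ 2) (delete 1 σ) ⊎ HasDecreasing k (suc a ∷ r ++ [ h ]))
    HasDecreasing-right {N} {0} _ = mk⇔ (λ _ → inj₁ (HasDecreasing-zero _)) (λ _ → HasDecreasing-zero _)
    HasDecreasing-right {N} {1} _ = mk⇔ (λ _ → inj₁ (HasDecreasing-zero _)) (λ _ → HasDecreasing-≤1 N _ ≤-refl)
    HasDecreasing-right {N} {suc (suc j)} N>rest = begin
      HasDecreasing (2 + j) (N ∷ (r ++ map φ σ) ++ [ suc a ])
        ∼⟨ HasDecreasing-∷-max N _ N>rest ⟩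
      HasDecreasing (1 + j) ((r ++ map φ σ) ++ [ suc a ])
        ≡⟨ cong (HasDecreasing (1 + j)) (++-assoc r (map φ σ) [ suc a ]) ⟩
      HasDecreasing (1 + j) (r ++ map φ σ ++ [ suc a ])
        ∼⟨ HasDecreasing-++ r (map φ σ ++ [ suc a ]) h (∈-++⁺ˡ h∈φσ) below ⟩
      (HasDecreasing (1 + j) (map φ σ ++ [ suc a ]) ⊎ HasDecreasing (1 + j) (r ++ [ h ]))
        ∼⟨ HasDecreasing-∷ʳ (map φ σ) (suc a) h (s≤s h≤a) (φ-above-h σ≥1)
           ⊎-⇔ ⇔.sym (HasDecreasing-∷-max (suc a) _ a≥τ) ⟩
      (HasDecreasing j (delete h (map φ σ)) ⊎ HasDecreasing (2 + j) (suc a ∷ r ++ [ h ]))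
        ≡⟨ cong (λ w → HasDecreasing j w ⊎ _) (delete-φ σ≥1) ⟩
      (HasDecreasing j (map φ (delete 1 σ)) ⊎ HasDecreasing (2 + j) (suc a ∷ r ++ [ h ]))
        ∼⟨ HasDecreasing-map φ _ (φ-increasing (All-resp-⊆ (delete-⊆ 1 σ) σ≥1)) ⊎-⇔ ⇔.refl ⟩
      (HasDecreasing j (delete 1 σ) ⊎ HasDecreasing (2 + j) (suc a ∷ r ++ [ h ])) ∎
      where
      a≥τ : All (_< suc a) (r ++ [ h ])
      a≥τ = All.++⁺ (All.map s≤s r≤a) (s≤s h≤a ∷ [])
      below : ∀ {x y} → x ∈ r → y ∈ map φ σ ++ [ suc a ] → y ≢ h → x < y
      below x∈ y∈ y≢h with ∈-++⁻ (map φ σ) y∈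
      ... | inj₁ y∈φσ = <-trans (s≤s (All.lookup r≤a x∈)) (φ-above-h σ≥1 y∈φσ y≢h)
      ... | inj₂ (here refl) = s≤s (All.lookup r≤a x∈)

record Glueable (h : ℕ) (r σ : List ℕ) : Set where
  field
    h≤α : h ≤ suc (length r)
    r≤α : All (_≤ suc (length r)) r
    σ≥1 : All (1 ≤_) σ
    σ≤b : All (_≤ length σ) σ
    1∈σ : 1 ∈ σ

module GlueLaws {h : ℕ} {r σ : List ℕ} (G : Glueable h r σ) where
  open Glueable G

  α : ℕ
  α = suc (length r)

  open Relabel h≤α

  π : List ℕ
  π = glueOneLine (h ∷ r) σ

  length-π : length π ≡ α + length σ
  length-π = cong suc (trans (length-++ r) (cong (_+_ (length r)) (length-map φ σ)))

  π≤ : All (_≤ length π) π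
  π≤ rewrite length-π =
    top ∷ All.++⁺ (All.map (λ x≤α → ≤-trans x≤α (m≤m+n α _)) r≤α) (All.map⁺ (All.map φ≤ σ≤b))
    where
    top : suc α ≤ α + length σ
    top = subst (_≤ α + length σ) (+-comm α 1) (+-monoʳ-≤ α (∈⇒length≥1 1∈σ))
    φ≤ : ∀ {x} → x ≤ length σ → φ x ≤ α + length σ
    φ≤ {1} _ = ≤-trans h≤α (m≤m+n α _)
    φ≤ {0} _ = +-monoʳ-≤ α z≤n
    φ≤ {suc (suc x)} x≤ = +-monoʳ-≤ α x≤

  bounded : ∀ {r′} → r′ ⊆ r → All (_< suc (length π)) ((r′ ++ map φ σ) ++ [ suc α ])
  bounded r′⊆ with top ∷ rest ← π≤ =
    All.map s≤s (All.++⁺ (All.++⁺ (All-resp-⊆ r′⊆ (All.++⁻ˡ r rest)) (All.++⁻ʳ r rest)) (top ∷ []))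

  avoids-L : ∀ k → avoidsδ k π ≡ avoidsδ k (headToEnd (h ∷ r)) ∧ avoidsδ k σ
  avoids-L k = trans (avoidsδ-∧ (Blocks.HasDecreasing-left σ≥1 1∈σ r r≤α {k}))
                     (∧-comm (avoidsδ k σ) _)

  avoids-D : ∀ k → avoidsδ k (headToEnd π) ≡ avoidsδ k (headToEnd (h ∷ r)) ∧ avoidsδ (k ∸ 2) (delete 1 σ)
  avoids-D k = trans (avoidsδ-∧ (Blocks.HasDecreasing-right σ≥1 1∈σ r r≤α {k = k} (bounded ⊆-refl)))
                     (∧-comm (avoidsδ (k ∸ 2) (delete 1 σ)) _)

  module _ (h≢1 : h ≢ 1) where

    delete1-tail : delete 1 (r ++ map φ σ) ≡ delete 1 r ++ map φ σ
    delete1-tail = trans (filter-++ (λ y → ¬? (y ≟ 1)) r (map φ σ))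
                         (cong (delete 1 r ++_) (delete-fresh 1 (All.map⁺ (All.map φ≢1 σ≥1))))
      where
      φ≢1 : ∀ {x} → 1 ≤ x → φ x ≢ 1
      φ≢1 {1} _ = h≢1
      φ≢1 {suc (suc x)} _ = >⇒≢ (≤-trans (s≤s (s≤s z≤n)) (m≤n+m (suc (suc x)) α))

    avoids-M : ∀ k → avoidsδ k (delete 1 π) ≡ avoidsδ k (headToEnd∖1 (h ∷ r)) ∧ avoidsδ k σ
    avoids-M k rewrite delete1-tail =
      trans (avoidsδ-∧ (Blocks.HasDecreasing-left σ≥1 1∈σ (delete 1 r) (All-resp-⊆ (delete-⊆ 1 r) r≤α) {k}))
            (∧-comm (avoidsδ k σ) _)

    avoids-E : ∀ k → avoidsδ k (headToEnd∖1 π) ≡ avoidsδ k (headToEnd∖1 (h ∷ r)) ∧ avoidsδ (k ∸ 2) (delete 1 σ)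
    avoids-E k rewrite delete1-tail =
      trans (avoidsδ-∧ (Blocks.HasDecreasing-right σ≥1 1∈σ (delete 1 r) (All-resp-⊆ (delete-⊆ 1 r) r≤α)
                                                      {k = k} (bounded (delete-⊆ 1 r))))
            (∧-comm (avoidsδ (k ∸ 2) (delete 1 σ)) _)

-- For τ = [1] the glued word is 2 ∷ σ shifted up by one, except that σ's entry 1 stays.
module GlueLaws₁ {σ : List ℕ} (G : Glueable 1 [] σ) where
  open Glueable G
  open GlueLaws G using (π; bounded)
  open Relabel h≤α
  open EquationalReasoning {k = equivalence}

  φσ∖1 : List ℕ
  φσ∖1 = map φ (delete 1 σ)

  σ∖1≥1 : All (1 ≤_) (delete 1 σ)
  σ∖1≥1 = All-resp-⊆ (delete-⊆ 1 σ) σ≥1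

  φσ∖1>2 : All (2 <_) φσ∖1
  φσ∖1>2 = All.map⁺ (All.tabulate λ x∈ → let x∈σ , x≢1 = ∈-delete⁻ 1 σ x∈ in
                                         φ-above (All.lookup σ≥1 x∈σ) x≢1)

  delete1-π : delete 1 π ≡ 2 ∷ φσ∖1
  delete1-π = cong (2 ∷_) (delete-φ σ≥1)

  avoids-M : ∀ k → avoidsδ k (delete 1 π) ≡ avoidsδ k [ 1 ] ∧ avoidsδ k (delete 1 σ)
  avoids-M k rewrite delete1-π = trans (avoidsδ-∧ HasDecreasing-M) (∧-comm (avoidsδ k (delete 1 σ)) _)
    where
    HasDecreasing-M : HasDecreasing k (2 ∷ φσ∖1) ⇔ (HasDecreasing k (delete 1 σ) ⊎ HasDecreasing k [ 1 ])
    HasDecreasing-M = begin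
      HasDecreasing k (2 ∷ φσ∖1)
        ∼⟨ HasDecreasing-∷-min 2 φσ∖1 φσ∖1>2 ⟩
      (HasDecreasing k φσ∖1 ⊎ k ≤ 1)
        ∼⟨ HasDecreasing-map φ _ (φ-increasing σ∖1≥1) ⊎-⇔ ⇔.sym HasDecreasing-[ 1 ] ⟩
      (HasDecreasing k (delete 1 σ) ⊎ HasDecreasing k [ 1 ]) ∎

  N : ℕ
  N = suc (length π)

  N>φσ∖1 : All (_< N) (φσ∖1 ++ [ 2 ])
  N>φσ∖1 = All-resp-⊆ (++⁺ (map⁺ φ (delete-⊆ 1 σ)) ⊆-refl) (bounded ⊆-refl)

  HasDecreasing-E-tail : ∀ {j} → HasDecreasing (2 + j) (N ∷ φσ∖1 ++ [ 2 ]) ⇔ HasDecreasing j (delete 1 σ)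
  HasDecreasing-E-tail {j} = begin
    HasDecreasing (2 + j) (N ∷ φσ∖1 ++ [ 2 ])
      ∼⟨ HasDecreasing-∷-max N _ N>φσ∖1 ⟩
    HasDecreasing (1 + j) (φσ∖1 ++ [ 2 ])
      ∼⟨ HasDecreasing-∷ʳ φσ∖1 2 1 (s≤s (s≤s z≤n)) (λ y∈ _ → All.lookup φσ∖1>2 y∈) ⟩
    HasDecreasing j (delete 1 φσ∖1)
      ≡⟨ cong (HasDecreasing j) (delete-fresh 1 (All.map (λ 2<y → >⇒≢ (<-trans (s≤s (s≤s z≤n)) 2<y)) φσ∖1>2)) ⟩
    HasDecreasing j φσ∖1
      ∼⟨ HasDecreasing-map φ _ (φ-increasing σ∖1≥1) ⟩
    HasDecreasing j (delete 1 σ) ∎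

  HasDecreasing-E : ∀ k → HasDecreasing k (N ∷ φσ∖1 ++ [ 2 ]) ⇔
                          (HasDecreasing (k ∸ 2) (delete 1 σ) ⊎ HasDecreasing k (2 ∷ [ 1 ]))
  HasDecreasing-E 0 = mk⇔ (λ _ → inj₁ (HasDecreasing-zero _)) (λ _ → HasDecreasing-zero _)
  HasDecreasing-E 1 = mk⇔ (λ _ → inj₁ (HasDecreasing-zero _)) (λ _ → HasDecreasing-≤1 N _ ≤-refl)
  HasDecreasing-E (suc (suc j)) = mk⇔ (inj₁ ∘ Equivalence.to HasDecreasing-E-tail) from
    where
    from : HasDecreasing j (delete 1 σ) ⊎ HasDecreasing (2 + j) (2 ∷ [ 1 ]) → HasDecreasing (2 + j) (N ∷ φσ∖1 ++ [ 2 ])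
    from (inj₁ d) = Equivalence.from HasDecreasing-E-tail d
    from (inj₂ d) with s≤s (s≤s z≤n) ← HasDecreasing⇒≤length d = Equivalence.from HasDecreasing-E-tail (HasDecreasing-zero _)

  avoids-E : ∀ k → avoidsδ k (headToEnd∖1 π) ≡ avoidsδ k (headToEnd∖1 [ 1 ]) ∧ avoidsδ (k ∸ 2) (delete 1 σ)
  avoids-E k rewrite delete-φ σ≥1 = trans (avoidsδ-∧ (HasDecreasing-E k)) (∧-comm (avoidsδ (k ∸ 2) (delete 1 σ)) _)

range : ℕ → ℕ → List ℕ
range s zero = []
range s (suc n) = suc s ∷ range (suc s) n

length-range : ∀ s n → length (range s n) ≡ n
length-range s zero = refl
length-range s (suc n) = cong suc (length-range (suc s) n)

∈-range⁻ : ∀ s n {x} → x ∈ range s n → s < x × x ≤ s + n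
∈-range⁻ s (suc n) (here refl) = ≤-refl , subst (suc s ≤_) (sym (+-suc s n)) (s≤s (m≤m+n s n))
∈-range⁻ s (suc n) {x} (there x∈) with s<x , x≤ ← ∈-range⁻ (suc s) n x∈ =
  <-trans (n<1+n s) s<x , subst (x ≤_) (sym (+-suc s n)) x≤

∈-range⁺ : ∀ s n {x} → s < x → x ≤ s + n → x ∈ range s n
∈-range⁺ s zero {x} s<x x≤ = contradiction (subst (x ≤_) (+-identityʳ s) x≤) (<⇒≱ s<x)
∈-range⁺ s (suc n) {x} s<x x≤ with x ≟ suc s
... | yes refl = here refl
... | no x≢ = there (∈-range⁺ (suc s) n (≤∧≢⇒< s<x (x≢ ∘ sym)) (subst (x ≤_) (+-suc s n) x≤))

range-++ : ∀ s m n → range s (m + n) ≡ range s m ++ range (s + m) n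
range-++ s zero n = cong (λ v → range v n) (sym (+-identityʳ s))
range-++ s (suc m) n = cong (suc s ∷_) (trans (range-++ (suc s) m n) (cong (λ v → range (suc s) m ++ range v n) (sym (+-suc s m))))

range-shift : ∀ s n → range s n ≡ map (_+_ s) (range 0 n)
range-shift s n = subst (λ v → range v n ≡ map (_+_ s) (range 0 n)) (+-identityʳ s) (shift s 0 n)
  where
  shift : ∀ s t n → range (s + t) n ≡ map (_+_ s) (range t n)
  shift s t zero = refl
  shift s t (suc n) = cong₂ _∷_ (sym (+-suc s t)) (trans (cong (λ v → range v n) (sym (+-suc s t))) (shift s (suc t) n))

range-unique : ∀ s n → Unique (range s n)
range-unique s zero = []
range-unique s (suc n) = All.tabulate (λ x∈ s≡x → <-irrefl s≡x (proj₁ (∈-range⁻ (suc s) n x∈))) ∷ range-unique (suc s) n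

nth-map-range : ∀ (g : ℕ → ℕ) s n {i} → i < n → nth (map g (range s n)) i ≡ g (suc (s + i))
nth-map-range g s (suc n) {zero} _ = cong (g ∘ suc) (sym (+-identityʳ s))
nth-map-range g s (suc n) {suc i} (s≤s i<n) = trans (nth-map-range g (suc s) n i<n) (cong (g ∘ suc) (sym (+-suc s i)))

nth-∈ : ∀ L {j} → j < length L → nth L j ∈ L
nth-∈ (x ∷ L) {zero} _ = here refl
nth-∈ (x ∷ L) {suc j} (s≤s j<) = there (nth-∈ L j<)

∈⇒nth : ∀ {L x} → x ∈ L → ∃[ j ] (j < length L × nth L j ≡ x)
∈⇒nth (here refl) = 0 , s≤s z≤n , refl
∈⇒nth (there x∈) with j , j< , refl ← ∈⇒nth x∈ = suc j , s≤s j< , refl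

nth-injective : ∀ {L} → Unique L → ∀ {i j} → i < length L → j < length L → nth L i ≡ nth L j → i ≡ j
nth-injective (_ ∷ _) {zero} {zero} _ _ _ = refl
nth-injective {x ∷ L} (x∉ ∷ _) {zero} {suc j} _ (s≤s j<) e = contradiction e (All.lookup x∉ (nth-∈ L j<))
nth-injective {x ∷ L} (x∉ ∷ _) {suc i} {zero} (s≤s i<) _ e = contradiction (sym e) (All.lookup x∉ (nth-∈ L i<))
nth-injective (_ ∷ u) {suc i} {suc j} (s≤s i<) (s≤s j<) e = cong suc (nth-injective u i< j< e)

nth-ext : ∀ xs ys → length xs ≡ length ys → (∀ {i} → i < length xs → nth xs i ≡ nth ys i) → xs ≡ ys
nth-ext [] [] _ _ = refl
nth-ext (x ∷ xs) (y ∷ ys) l h = cong₂ _∷_ (h (s≤s z≤n)) (nth-ext xs ys (suc-injective l) (h ∘ s≤s))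

InRange : ℕ → ℕ → Set
InRange n x = 1 ≤ x × x ≤ n

IsPerm : ℕ → List ℕ → Set
IsPerm n xs = Unique xs × length xs ≡ n × All (InRange n) xs

InRange⇒∈-range : ∀ {n x} → InRange n x → x ∈ range 0 n
InRange⇒∈-range (x≥1 , x≤n) = ∈-range⁺ 0 _ x≥1 x≤n

∈-range⇒InRange : ∀ {n x} → x ∈ range 0 n → InRange n x
∈-range⇒InRange x∈ = ∈-range⁻ 0 _ x∈

IsPerm⇒∈ : ∀ {n xs x} → IsPerm n xs → InRange n x → x ∈ xs
IsPerm⇒∈ {n} {xs} {x} (u , refl , inR) x-inR with x ∈? xs
... | yes x∈ = x∈
... | no x∉ = contradiction (≤-<-trans (Unique-⊆⇒length-≤ u xs⊆) shorter) (<-irrefl refl)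
  where
  xs⊆ : ∀ {y} → y ∈ xs → y ∈ delete x (range 0 (length xs))
  xs⊆ {y} y∈ = ∈-delete⁺ x _ (InRange⇒∈-range (All.lookup inR y∈)) λ { refl → x∉ y∈ }
  shorter : length (delete x (range 0 (length xs))) < length xs
  shorter = subst (length (delete x (range 0 (length xs))) <_) (length-range 0 (length xs))
              (filter-notAll (λ y → ¬? (y ≟ x)) _ (Any.map (λ { refl ¬≢ → ¬≢ refl }) (InRange⇒∈-range x-inR)))

IsPerm-fromMembership : ∀ {n xs} → Unique xs → (∀ {x} → x ∈ xs → InRange n x) → (∀ {x} → InRange n x → x ∈ xs) →
                        IsPerm n xs
IsPerm-fromMembership {n} u inRange complete =
  u ,
  trans (Unique-≐⇒length-≡ u (range-unique 0 n) (InRange⇒∈-range ∘ inRange) (complete ∘ ∈-range⇒InRange))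
        (length-range 0 n) ,
  All.tabulate inRange

insertions-sound : ∀ (x : ℕ) ρ {π} → π ∈ insertions x ρ → ∃[ xs ] ∃[ ys ] (ρ ≡ xs ++ ys × π ≡ xs ++ x ∷ ys)
insertions-sound x [] (here refl) = [] , [] , refl , refl
insertions-sound x (y ∷ ρ) (here refl) = [] , y ∷ ρ , refl , refl
insertions-sound x (y ∷ ρ) (there π∈) with π′ , π′∈ , refl ← ∈-map⁻ (y ∷_) π∈
  with xs , ys , refl , refl ← insertions-sound x ρ π′∈ = y ∷ xs , ys , refl , refl

insertions-complete : ∀ (x : ℕ) xs ys → xs ++ x ∷ ys ∈ insertions x (xs ++ ys)
insertions-complete x [] [] = here refl
insertions-complete x [] (y ∷ ys) = here refl
insertions-complete x (z ∷ xs) ys = there (∈-map⁺ (z ∷_) (insertions-complete x xs ys))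

∈-insert⁻ : ∀ {w x : ℕ} xs ys → w ∈ xs ++ x ∷ ys → w ≡ x ⊎ w ∈ xs ++ ys
∈-insert⁻ [] ys (here e) = inj₁ e
∈-insert⁻ [] ys (there w∈) = inj₂ w∈
∈-insert⁻ (z ∷ xs) ys (here e) = inj₂ (here e)
∈-insert⁻ (z ∷ xs) ys (there w∈) = Data.Sum.map₂ there (∈-insert⁻ xs ys w∈)

⊆-insert : ∀ {w x : ℕ} xs ys → w ∈ xs ++ ys → w ∈ xs ++ x ∷ ys
⊆-insert [] ys w∈ = there w∈
⊆-insert (z ∷ xs) ys (here e) = here e
⊆-insert (z ∷ xs) ys (there w∈) = there (⊆-insert xs ys w∈)

Unique-insert : ∀ (x : ℕ) xs ys → Unique (xs ++ x ∷ ys) ⇔ (x ∉ xs ++ ys × Unique (xs ++ ys))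
Unique-insert x xs ys = mk⇔ (to xs) (λ (x∉ , u) → from xs x∉ u)
  where
  to : ∀ xs → Unique (xs ++ x ∷ ys) → x ∉ xs ++ ys × Unique (xs ++ ys)
  to [] (x∉ ∷ u) = (λ x∈ → All.lookup x∉ x∈ refl) , u
  to (z ∷ xs) (z∉ ∷ u) with x∉ , u′ ← to xs u =
    (λ { (here refl) → All.lookup z∉ (∈-insert xs) refl ; (there x∈) → x∉ x∈ }) ,
    All.tabulate (λ w∈ → All.lookup z∉ (⊆-insert xs ys w∈)) ∷ u′
  from : ∀ xs → x ∉ xs ++ ys → Unique (xs ++ ys) → Unique (xs ++ x ∷ ys)
  from [] x∉ u = All.tabulate (λ { w∈ refl → x∉ w∈ }) ∷ u
  from (z ∷ xs) x∉ (z∉ ∷ u) = All.tabulate z≢ ∷ from xs (x∉ ∘ there) u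
    where
    z≢ : ∀ {w} → w ∈ xs ++ x ∷ ys → z ≢ w
    z≢ w∈ z≡w with ∈-insert⁻ xs ys w∈
    ... | inj₁ refl = x∉ (here (sym z≡w))
    ... | inj₂ w∈′ = All.lookup z∉ w∈′ z≡w

IsPerm-insert : ∀ n xs ys → IsPerm (suc n) (xs ++ suc n ∷ ys) ⇔ IsPerm n (xs ++ ys)
IsPerm-insert n xs ys = mk⇔ to from
  where
  length-insert : length (xs ++ suc n ∷ ys) ≡ suc (length (xs ++ ys))
  length-insert = trans (length-++ xs) (trans (+-suc (length xs) _) (cong suc (sym (length-++ xs))))
  to : IsPerm (suc n) (xs ++ suc n ∷ ys) → IsPerm n (xs ++ ys)
  to (u , len , inR) with n∉ , u′ ← Equivalence.to (Unique-insert (suc n) xs ys) u =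
    u′ , suc-injective (trans (sym length-insert) len) ,
    All.tabulate λ {w} w∈ → let w≥1 , w≤ = All.lookup inR (⊆-insert xs ys w∈) in
      w≥1 , ≤-pred (≤∧≢⇒< w≤ λ { refl → n∉ w∈ })
  from : IsPerm n (xs ++ ys) → IsPerm (suc n) (xs ++ suc n ∷ ys)
  from (u , len , inR) =
    Equivalence.from (Unique-insert (suc n) xs ys) ((λ n∈ → <-irrefl refl (proj₂ (All.lookup inR n∈))) , u) ,
    trans length-insert (cong suc len) ,
    All.tabulate λ w∈ → case (∈-insert⁻ xs ys w∈)
    where
    case : ∀ {w} → w ≡ suc n ⊎ w ∈ xs ++ ys → InRange (suc n) w
    case (inj₁ refl) = s≤s z≤n , ≤-refl
    case (inj₂ w∈) = let w≥1 , w≤ = All.lookup inR w∈ in w≥1 , m≤n⇒m≤1+n w≤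

perms-sound : ∀ n {π} → π ∈ perms n → IsPerm n π
perms-sound zero (here refl) = [] , refl , []
perms-sound (suc n) π∈ with ρ , ρ∈ , π∈′ ← ∈-concatMap⁻ (insertions (suc n)) (perms n) π∈
  with xs , ys , refl , refl ← insertions-sound (suc n) ρ π∈′ = Equivalence.from (IsPerm-insert n xs ys) (perms-sound n ρ∈)

perms-complete : ∀ n {π} → IsPerm n π → π ∈ perms n
perms-complete zero {[]} _ = here refl
perms-complete (suc n) P with xs , ys , refl ← ∈-∃++ (IsPerm⇒∈ P (s≤s z≤n , ≤-refl)) =
  ∈-concatMap⁺ (insertions (suc n)) (perms-complete n (Equivalence.to (IsPerm-insert n xs ys) P)) (insertions-complete (suc n) xs ys)

perms-unique : ∀ n → Unique (perms n)
perms-unique zero = [] ∷ []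
perms-unique (suc n) = Unique-concatMap⁺ (insertions (suc n)) (perms-unique n) (λ ρ∈ → insertions-unique (suc n) _ (n∉ ρ∈))
  (λ ρ∈ ρ′∈ π∈ π∈′ → trans (sym (delete-insertion (suc n) _ (n∉ ρ∈) π∈))
                           (delete-insertion (suc n) _ (n∉ ρ′∈) π∈′))
  where
  n∉ : ∀ {ρ} → ρ ∈ perms n → suc n ∉ ρ
  n∉ ρ∈ n∈ = <-irrefl refl (proj₂ (All.lookup (proj₂ (proj₂ (perms-sound n ρ∈))) n∈))
  insertions-unique : ∀ (x : ℕ) ρ → x ∉ ρ → Unique (insertions x ρ)
  insertions-unique x [] _ = [] ∷ []
  insertions-unique x (y ∷ ρ) x∉ =
    All.tabulate (λ π∈ e → let _ , _ , e′ = ∈-map⁻ (y ∷_) π∈ in x∉ (here (∷-injectiveˡ (trans e e′))))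
    ∷ Unique.map⁺ ∷-injectiveʳ (insertions-unique x ρ (x∉ ∘ there))
  delete-insertion : ∀ (x : ℕ) ρ {π} → x ∉ ρ → π ∈ insertions x ρ → delete x π ≡ ρ
  delete-insertion x ρ x∉ π∈ with xs , ys , refl , refl ← insertions-sound x ρ π∈ =
    trans (filter-++ (λ y → ¬? (y ≟ x)) xs (x ∷ ys))
      (trans (cong (delete x xs ++_) (delete-here x ys))
        (trans (sym (filter-++ (λ y → ¬? (y ≟ x)) xs ys)) (delete-fresh x (All.tabulate λ { w∈ refl → x∉ w∈ }))))

distinctᵇ⇔Unique : ∀ xs → distinctᵇ xs ≡ true ⇔ Unique xs
distinctᵇ⇔Unique xs = mk⇔ (to xs) (from xs)
  where
  elemᵇ⇔∈ : ∀ x xs → elemᵇ x xs ≡ true ⇔ x ∈ xs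
  elemᵇ⇔∈ x [] = mk⇔ (λ ()) (λ ())
  elemᵇ⇔∈ x (y ∷ xs) with x ≟ y
  ... | yes refl rewrite ≡⇒≡ᵇ-true {x} refl = mk⇔ (λ _ → here refl) (λ _ → refl)
  ... | no x≢y rewrite ≢⇒≡ᵇ-false x≢y =
    mk⇔ (there ∘ Equivalence.to (elemᵇ⇔∈ x xs)) (λ { (here refl) → contradiction refl x≢y
                                                   ; (there x∈) → Equivalence.from (elemᵇ⇔∈ x xs) x∈ })
  to : ∀ xs → distinctᵇ xs ≡ true → Unique xs
  to [] _ = []
  to (x ∷ xs) e with elemᵇ x xs in x∈?
  ... | false = All.tabulate (λ y∈ x≡y → ¬elem (subst (_∈ xs) (sym x≡y) y∈)) ∷ to xs e
    where
    ¬elem : x ∉ xs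
    ¬elem x∈ with () ← trans (sym x∈?) (Equivalence.from (elemᵇ⇔∈ x xs) x∈)
  from : ∀ xs → Unique xs → distinctᵇ xs ≡ true
  from [] _ = refl
  from (x ∷ xs) (x∉ ∷ u) with elemᵇ x xs in x∈?
  ... | false = from xs u
  ... | true = contradiction (Equivalence.to (elemᵇ⇔∈ x xs) x∈?) (λ x∈ → All.lookup x∉ x∈ refl)

headOr : ℕ → List ℕ → ℕ
headOr w [] = w
headOr w (z ∷ _) = z

-- the entry after x in L; w if x is the last entry (and 0 if x ∉ L)
nextIn : ℕ → ℕ → List ℕ → ℕ
nextIn w x [] = 0
nextIn w x (y ∷ ys) = if x ≡ᵇ y then headOr w ys else nextIn w x ys

next : List ℕ → ℕ → ℕ
next C x = nextIn (headOr 0 C) x C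

oneLine : List ℕ → List ℕ
oneLine C = map (next C) (range 0 (length C))

length-oneLine : ∀ C → length (oneLine C) ≡ length C
length-oneLine C = trans (length-map (next C) (range 0 (length C))) (length-range 0 (length C))

app-oneLine : ∀ C {x} → InRange (length C) x → app (oneLine C) x ≡ next C x
app-oneLine C {suc x} (_ , x<) = nth-map-range (next C) 0 (length C) x<

nextIn-nth : ∀ w {L} → Unique L → ∀ {j} → suc j < length L → nextIn w (nth L j) L ≡ nth L (suc j)
nextIn-nth w {y ∷ _ ∷ _} _ {zero} _ rewrite ≡⇒≡ᵇ-true {y} refl = refl
nextIn-nth w {y ∷ ys} (y∉ ∷ u) {suc j} (s≤s j<)
  rewrite ≢⇒≡ᵇ-false (All.lookup y∉ (nth-∈ ys (<-trans (n<1+n j) j<)) ∘ sym) =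
  nextIn-nth w u j<

nextIn-last : ∀ w {L} → Unique L → ∀ {j} → suc j ≡ length L → nextIn w (nth L j) L ≡ w
nextIn-last w {y ∷ []} _ {zero} _ rewrite ≡⇒≡ᵇ-true {y} refl = refl
nextIn-last w {y ∷ ys} (y∉ ∷ u) {suc j} l
  rewrite ≢⇒≡ᵇ-false (All.lookup y∉ (nth-∈ ys (≤-reflexive (suc-injective l))) ∘ sym) =
  nextIn-last w u (suc-injective l)

nextIn-∈ : ∀ w {x} L → x ∈ L → nextIn w x L ≡ w ⊎ nextIn w x L ∈ L
nextIn-∈ w {x} (y ∷ L) x∈ with x ≡ᵇ y in e
nextIn-∈ w (y ∷ []) _ | true = inj₁ refl
nextIn-∈ w (y ∷ z ∷ L) _ | true = inj₂ (there (here refl))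
nextIn-∈ w (y ∷ L) (here refl) | false = contradiction refl (≡ᵇ-false⇒≢ {y} e)
nextIn-∈ w (y ∷ L) (there x∈) | false = Data.Sum.map₂ there (nextIn-∈ w L x∈)

next-∈ : ∀ {C x} → x ∈ C → next C x ∈ C
next-∈ {y ∷ C} {x} x∈ with nextIn-∈ y (y ∷ C) x∈
... | inj₁ e = subst (_∈ y ∷ C) (sym e) (here refl)
... | inj₂ n∈ = n∈

iterate : List ℕ → ℕ → ℕ → ℕ
iterate π zero c = c
iterate π (suc j) c = iterate π j (app π c)

iterate-suc : ∀ π j c → iterate π (suc j) c ≡ app π (iterate π j c)
iterate-suc π zero c = refl
iterate-suc π (suc j) c = iterate-suc π j (app π c)

length-iterateFrom : ∀ π c m → length (iterateFrom π c m) ≡ m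
length-iterateFrom π c zero = refl
length-iterateFrom π c (suc m) = cong suc (length-iterateFrom π (app π c) m)

nth-iterateFrom : ∀ π c m {j} → j < m → nth (iterateFrom π c m) j ≡ iterate π j c
nth-iterateFrom π c (suc m) {zero} _ = refl
nth-iterateFrom π c (suc m) {suc j} (s≤s j<) = nth-iterateFrom π (app π c) m j<

cycleForm-oneLine : ∀ {n T} → IsPerm n (1 ∷ T) → cycleForm (oneLine (1 ∷ T)) ≡ 1 ∷ T
cycleForm-oneLine {n} {T} (u , len , inR) =
  nth-ext _ C length-cycleForm λ {j} j< →
    trans (nth-iterateFrom π 1 (length π) (subst (j <_) (length-iterateFrom π 1 _) j<)) (orbit (subst (j <_) length-cycleForm j<))
  where
  C : List ℕ
  C = 1 ∷ T
  π : List ℕ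
  π = oneLine C
  length-cycleForm : length (cycleForm π) ≡ length C
  length-cycleForm = trans (length-iterateFrom π 1 (length π)) (length-oneLine C)
  orbit : ∀ {j} → j < length C → iterate π j 1 ≡ nth C j
  orbit {zero} _ = refl
  orbit {suc j} sj< = begin
    iterate π (suc j) 1      ≡⟨ iterate-suc π j 1 ⟩
    app π (iterate π j 1)    ≡⟨ cong (app π) (orbit j<) ⟩
    app π (nth C j)          ≡⟨ app-oneLine C (subst (λ m → InRange m (nth C j)) (sym len) (All.lookup inR (nth-∈ C j<))) ⟩
    next C (nth C j)         ≡⟨ nextIn-nth 1 u sj< ⟩
    nth C (suc j)            ∎
    where
    open ≡-Reasoning
    j< : j < length C
    j< = <-trans (n<1+n j) sj<

app-InRange : ∀ {n π x} → IsPerm n π → InRange n x → InRange n (app π x)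
app-InRange {x = suc x} (_ , refl , inR) (_ , x<) = All.lookup inR (nth-∈ _ x<)

app-injective : ∀ {n π x y} → IsPerm n π → InRange n x → InRange n y → app π x ≡ app π y → x ≡ y
app-injective {x = suc x} {suc y} (u , refl , _) (_ , x<) (_ , y<) e = cong suc (nth-injective u x< y< e)

iterate-InRange : ∀ {n π c} → IsPerm n π → InRange n c → ∀ j → InRange n (iterate π j c)
iterate-InRange P c-inR zero = c-inR
iterate-InRange P c-inR (suc j) = iterate-InRange P (app-InRange P c-inR) j

head-cycleForm : ∀ π → 1 ≤ length π → headOr 0 (cycleForm π) ≡ 1
head-cycleForm (_ ∷ _) _ = refl

module CycleForm {n : ℕ} {π : List ℕ} (P : IsPerm (suc n) π) (cyclic : distinctᵇ (cycleForm π) ≡ true) where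

  C : List ℕ
  C = cycleForm π

  length-C : length C ≡ suc n
  length-C = trans (length-iterateFrom π 1 (length π)) (proj₁ (proj₂ P))

  nth-C : ∀ {j} → j < length C → nth C j ≡ iterate π j 1
  nth-C j< = nth-iterateFrom π 1 (length π) (subst (_ <_) (length-iterateFrom π 1 (length π)) j<)

  unique-C : Unique C
  unique-C = Equivalence.to (distinctᵇ⇔Unique C) cyclic

  IsPerm-C : IsPerm (suc n) C
  IsPerm-C = unique-C , length-C , nth-All C λ {j} j< →
    subst (InRange (suc n)) (sym (nth-C j<)) (iterate-InRange P (s≤s z≤n , s≤s z≤n) j)

  orbit-closes : iterate π (suc n) 1 ≡ 1
  orbit-closes with ∈⇒nth (IsPerm⇒∈ IsPerm-C (iterate-InRange P (s≤s z≤n , s≤s z≤n) (suc n)))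
  ... | zero , 0< , e = trans (sym e) (nth-C 0<)
  ... | suc m , m< , e = contradiction (subst (suc m <_) length-C m<) (<-irrefl (cong suc (sym n≡m)))
    where
    m<C : m < length C
    m<C = <-trans (n<1+n m) m<
    n<C : n < length C
    n<C = subst (n <_) (sym length-C) ≤-refl
    n≡m : n ≡ m
    n≡m = nth-injective unique-C n<C m<C (begin
      nth C n                  ≡⟨ nth-C n<C ⟩
      iterate π n 1            ≡⟨ app-injective P (iterate-InRange P (s≤s z≤n , s≤s z≤n) n)
                                                  (iterate-InRange P (s≤s z≤n , s≤s z≤n) m)
                                    (trans (sym (iterate-suc π n 1)) (trans (sym e) (trans (nth-C m<) (iterate-suc π m 1)))) ⟩
      iterate π m 1            ≡⟨ sym (nth-C m<C) ⟩
      nth C m                  ∎)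
      where open ≡-Reasoning

  next-C : ∀ {x} → InRange (suc n) x → next C x ≡ app π x
  next-C x-inR with j , j< , refl ← ∈⇒nth (IsPerm⇒∈ IsPerm-C x-inR) with suc j <? length C
  ... | yes sj< = trans (nextIn-nth _ unique-C sj<) (trans (nth-C sj<) (trans (iterate-suc π j 1) (cong (app π) (sym (nth-C j<)))))
  ... | no sj≮ = begin
    next C (nth C j)         ≡⟨ nextIn-last _ unique-C sj≡ ⟩
    headOr 0 C               ≡⟨ head-cycleForm π (subst (1 ≤_) (sym (proj₁ (proj₂ P))) (s≤s z≤n)) ⟩
    1                        ≡⟨ sym orbit-closes ⟩
    iterate π (suc n) 1      ≡⟨ iterate-suc π n 1 ⟩
    app π (iterate π n 1)    ≡⟨ cong (app π) (sym (nth-C (subst (n <_) (sym length-C) ≤-refl))) ⟩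
    app π (nth C n)          ≡⟨ cong (app π ∘ nth C) (suc-injective (trans sj≡ length-C)) ⟨
    app π (nth C j)          ∎
    where
    open ≡-Reasoning
    sj≡ : suc j ≡ length C
    sj≡ = ≤-antisym j< (≮⇒≥ sj≮)

oneLine-cycleForm : ∀ {n π} → IsPerm n π → distinctᵇ (cycleForm π) ≡ true → oneLine (cycleForm π) ≡ π
oneLine-cycleForm {zero} {[]} _ _ = refl
oneLine-cycleForm {suc n} {π} P cyclic =
  nth-ext _ π (trans (length-oneLine C) (trans length-C (sym (proj₁ (proj₂ P))))) λ {i} i< →
    let i<n = subst (i <_) (trans (length-oneLine C) length-C) i< in
    trans (nth-map-range (next C) 0 (length C) (subst (i <_) (sym length-C) i<n)) (next-C (s≤s z≤n , i<n))
  where open CycleForm P cyclic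

module NextInjective {c : ℕ} {C′ : List ℕ} (u : Unique (c ∷ C′)) where

  C : List ℕ
  C = c ∷ C′

  next-nth : ∀ {i} → i < length C →
             ∃[ i′ ] (i′ < length C × next C (nth C i) ≡ nth C i′ × (i′ ≡ suc i ⊎ (i′ ≡ 0 × suc i ≡ length C)))
  next-nth {i} i< with suc i <? length C
  ... | yes si< = suc i , si< , nextIn-nth c u si< , inj₁ refl
  ... | no si≮ = 0 , s≤s z≤n , nextIn-last c u si≡ , inj₂ (refl , si≡)
    where
    si≡ : suc i ≡ length C
    si≡ = ≤-antisym i< (≮⇒≥ si≮)

  next-injective : ∀ {x y} → x ∈ C → y ∈ C → next C x ≡ next C y → x ≡ y
  next-injective x∈ y∈ e with i , i< , refl ← ∈⇒nth x∈ with j , j< , refl ← ∈⇒nth y∈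
    with i′ , i′< , ei , si ← next-nth i< with j′ , j′< , ej , sj ← next-nth j<
    with nth-injective u i′< j′< (trans (sym ei) (trans e ej))
  ... | refl with si | sj
  ...   | inj₁ refl | inj₁ e′ = cong (nth C) (suc-injective e′)
  ...   | inj₂ (refl , si≡) | inj₂ (_ , sj≡) = cong (nth C) (suc-injective (trans si≡ (sym sj≡)))
  ...   | inj₁ refl | inj₂ (() , _)
  ...   | inj₂ (refl , _) | inj₁ ()

oneLine-IsPerm : ∀ {n T} → IsPerm n (1 ∷ T) → IsPerm n (oneLine (1 ∷ T))
oneLine-IsPerm {n} {T} P@(u , len , inR) =
  Unique-map⁺ (next C) (λ x∈ y∈ → NextInjective.next-injective u (range⊆C x∈) (range⊆C y∈)) (range-unique 0 _) ,
  trans (length-oneLine C) len ,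
  All.map⁺ (All.tabulate (λ x∈ → All.lookup inR (next-∈ (range⊆C x∈))))
  where
  C : List ℕ
  C = 1 ∷ T
  range⊆C : ∀ {x} → x ∈ range 0 (length C) → x ∈ C
  range⊆C x∈ = IsPerm⇒∈ P (subst (λ m → InRange m _) len (∈-range⇒InRange x∈))

IsCycle213 : ℕ → List ℕ → Set
IsCycle213 n C = IsPerm n C × headOr 0 C ≡ 1 × ¬ Has213 C

next-≢head : ∀ {c} L {v} → v ≢ c → next (c ∷ L) v ≡ nextIn c v L
next-≢head L v≢c rewrite ≢⇒≡ᵇ-false v≢c = refl

glue : List ℕ → List ℕ → List ℕ
glue Cτ Cσ = 1 ∷ map (_+_ (length Cτ)) Cσ ++ drop 1 Cτ

nextIn-++-∉ : ∀ w {v} M T → v ∉ M → nextIn w v (M ++ T) ≡ nextIn w v T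
nextIn-++-∉ w [] T _ = refl
nextIn-++-∉ w {v} (y ∷ M) T v∉ rewrite ≢⇒≡ᵇ-false (v∉ ∘ here) = nextIn-++-∉ w M T (v∉ ∘ there)

nextIn-++-∈ : ∀ w {v} M T → v ∈ M → nextIn w v (M ++ T) ≡ nextIn (headOr w T) v M
nextIn-++-∈ w {v} (y ∷ M) T v∈ with v ≡ᵇ y in e
nextIn-++-∈ w (y ∷ []) T _ | true = refl
nextIn-++-∈ w (y ∷ _ ∷ _) T _ | true = refl
nextIn-++-∈ w (y ∷ M) T (here refl) | false = contradiction refl (≡ᵇ-false⇒≢ {y} e)
nextIn-++-∈ w (y ∷ M) T (there v∈) | false = nextIn-++-∈ w M T v∈

nextIn-shift : ∀ h a {x} L → 1 ∉ drop 1 L → x ∈ L → nextIn h (a + x) (map (_+_ a) L) ≡ relabel h a (nextIn 1 x L)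
nextIn-shift h a {x} (y ∷ L) 1∉L x∈ with x ≡ᵇ y in e
... | true rewrite ≡⇒≡ᵇ-true {a + x} {a + y} (cong (_+_ a) (≡ᵇ⇒≡-true {x} e)) = headOr-shift L 1∉L
  where
  headOr-shift : ∀ L → 1 ∉ L → headOr h (map (_+_ a) L) ≡ relabel h a (headOr 1 L)
  headOr-shift [] _ = refl
  headOr-shift (z ∷ L) 1∉ = sym (relabel-≢1 h a (1∉ ∘ here ∘ sym))
... | false with x∈
...   | here x≡y = contradiction x≡y (≡ᵇ-false⇒≢ {x} e)
...   | there x∈L rewrite ≢⇒≡ᵇ-false (≡ᵇ-false⇒≢ {x} e ∘ +-cancelˡ-≡ a x y) =
  nextIn-shift h a L (1∉L ∘ drop1-⊆ L) x∈L
  where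
  drop1-⊆ : ∀ L {z} → z ∈ drop 1 L → z ∈ L
  drop1-⊆ (_ ∷ _) = there

module GlueWords {a b : ℕ} {T S : List ℕ} (Pτ : IsPerm a (1 ∷ T)) (Pσ : IsPerm b (1 ∷ S)) where

  α : ℕ
  α = suc (length T)

  α≡a : α ≡ a
  α≡a = proj₁ (proj₂ Pτ)

  M : List ℕ
  M = map (_+_ α) (1 ∷ S)

  M>α : ∀ {w} → w ∈ M → α < w
  M>α w∈ with x , x∈ , refl ← ∈-map⁻ (_+_ α) w∈ =
    subst (_≤ α + x) (+-comm α 1) (+-monoʳ-≤ α (proj₁ (All.lookup (proj₂ (proj₂ Pσ)) x∈)))

  T≤α : ∀ {w} → w ∈ T → w ≤ α
  T≤α w∈ = subst (_ ≤_) (sym α≡a) (proj₂ (All.lookup (proj₂ (proj₂ Pτ)) (there w∈)))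

  glue-IsPerm : IsPerm (a + b) (glue (1 ∷ T) (1 ∷ S))
  glue-IsPerm = unique , length-glue , inRange
    where
    1∉ : ∀ {w} → w ∈ M ++ T → 1 ≢ w
    1∉ w∈ refl with ∈-++⁻ M w∈
    ... | inj₁ 1∈M = <⇒≱ (M>α 1∈M) (s≤s z≤n)
    ... | inj₂ 1∈T = All.lookup (AllPairs.head (proj₁ Pτ)) 1∈T refl
    unique : Unique (glue (1 ∷ T) (1 ∷ S))
    unique = All.tabulate 1∉ ∷ Unique.++⁺ (Unique.map⁺ (+-cancelˡ-≡ α _ _) (proj₁ Pσ)) (AllPairs.tail (proj₁ Pτ))
                                          (λ (w∈M , w∈T) → <⇒≱ (M>α w∈M) (T≤α w∈T))
    length-glue : length (glue (1 ∷ T) (1 ∷ S)) ≡ a + b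
    length-glue = trans (cong suc (trans (length-++ M) (trans (cong (_+ length T) (length-map (_+_ α) (1 ∷ S)))
                                                                (+-comm (length (1 ∷ S)) (length T)))))
                        (cong₂ _+_ α≡a (proj₁ (proj₂ Pσ)))
    inRange-M : All (InRange (a + b)) M
    inRange-M = All.map⁺ (All.map (λ {x} (x≥1 , x≤b) → ≤-trans (s≤s z≤n) (m≤m+n α x) ,
                                                       subst (λ v → v + x ≤ a + b) (sym α≡a) (+-monoʳ-≤ a x≤b))
                                  (proj₂ (proj₂ Pσ)))
    inRange-T : All (InRange (a + b)) T
    inRange-T = All.map (λ (w≥1 , w≤a) → w≥1 , ≤-trans w≤a (m≤m+n a b)) (All.tail (proj₂ (proj₂ Pτ)))
    inRange : All (InRange (a + b)) (glue (1 ∷ T) (1 ∷ S))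
    inRange = (≤-refl , ≤-trans (subst (1 ≤_) α≡a (s≤s z≤n)) (m≤m+n a b)) ∷ All.++⁺ inRange-M inRange-T

  -- An occurrence of 213 cannot straddle the blocks M and T, since M lies above T.
  glue-avoids213 : ¬ Has213 (1 ∷ T) → ¬ Has213 (1 ∷ S) → ¬ Has213 (glue (1 ∷ T) (1 ∷ S))
  glue-avoids213 ¬τ ¬σ (_ , y , _ , refl ∷ t⊆ , y<1 , _) =
    <⇒≱ y<1 (proj₁ (All.lookup (proj₂ (proj₂ glue-IsPerm)) (there (lookup t⊆ (here refl)))))
  glue-avoids213 ¬τ ¬σ (x , y , z , _ ∷ʳ t⊆ , y<x , x<z) with ⊆-++-split M T t⊆
  ... | [] , _ , refl , _ , t⊆T = ¬τ (x , y , z , 1 ∷ʳ t⊆T , y<x , x<z)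
  ... | _ ∷ [] , _ , refl , x⊆M , yz⊆T =
    <-asym x<z (≤-<-trans (T≤α (lookup yz⊆T (there (here refl)))) (M>α (lookup x⊆M (here refl))))
  ... | _ ∷ _ ∷ [] , _ , refl , xy⊆M , z⊆T =
    <-asym x<z (≤-<-trans (T≤α (lookup z⊆T (here refl))) (M>α (lookup xy⊆M (here refl))))
  ... | _ ∷ _ ∷ _ ∷ [] , [] , refl , t⊆M , _ =
    ¬σ (Equivalence.to (Has213-shift α (1 ∷ S)) (x , y , z , t⊆M , y<x , x<z))

  glue-IsCycle213 : ¬ Has213 (1 ∷ T) → ¬ Has213 (1 ∷ S) → IsCycle213 (a + b) (glue (1 ∷ T) (1 ∷ S))
  glue-IsCycle213 ¬τ ¬σ = glue-IsPerm , refl , glue-avoids213 ¬τ ¬σ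

  G : List ℕ
  G = glue (1 ∷ T) (1 ∷ S)

  h : ℕ
  h = headOr 1 T

  r : List ℕ
  r = map (next (1 ∷ T)) (range 1 (length T))

  σ : List ℕ
  σ = oneLine (1 ∷ S)

  length-r : length r ≡ length T
  length-r = trans (length-map _ (range 1 (length T))) (length-range 1 (length T))

  next-left : ∀ {v} → v ∈ range 1 (length T) → next G v ≡ next (1 ∷ T) v
  next-left {v} v∈ with 1<v , v≤α ← ∈-range⁻ 1 (length T) v∈ = begin
    next G v             ≡⟨ next-≢head (M ++ T) (<⇒≢ 1<v ∘ sym) ⟩
    nextIn 1 v (M ++ T)  ≡⟨ nextIn-++-∉ 1 M T (λ v∈M → <⇒≱ (M>α v∈M) v≤α) ⟩
    nextIn 1 v T         ≡⟨ next-≢head T (<⇒≢ 1<v ∘ sym) ⟨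
    next (1 ∷ T) v       ∎
    where open ≡-Reasoning

  -- the last entry of M is followed by the head of T (or by 1), i.e. by h = τ(1)
  next-right : ∀ {x} → x ∈ range 0 (suc (length S)) → next G (α + x) ≡ relabel h α (next (1 ∷ S) x)
  next-right {x} x∈ with x≥1 , x≤ ← ∈-range⁻ 0 (suc (length S)) x∈ = begin
    next G (α + x)              ≡⟨ next-≢head (M ++ T) (<⇒≢ (+-mono-≤ {1} {α} (s≤s z≤n) x≥1) ∘ sym) ⟩
    nextIn 1 (α + x) (M ++ T)   ≡⟨ nextIn-++-∈ 1 M T (∈-map⁺ (_+_ α) x∈σ) ⟩
    nextIn h (α + x) M          ≡⟨ nextIn-shift h α (1 ∷ S) (λ 1∈S → All.lookup (AllPairs.head (proj₁ Pσ)) 1∈S refl)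
                                                x∈σ ⟩
    relabel h α (nextIn 1 x (1 ∷ S)) ∎
    where
    open ≡-Reasoning
    x∈σ : x ∈ 1 ∷ S
    x∈σ = IsPerm⇒∈ Pσ (x≥1 , subst (x ≤_) (proj₁ (proj₂ Pσ)) x≤)

  oneLine-glue : oneLine G ≡ glueOneLine (oneLine (1 ∷ T)) σ
  oneLine-glue = begin
    oneLine G
      ≡⟨ cong (λ L → next G 1 ∷ map (next G) (range 1 L)) length-M++T ⟩
    next G 1 ∷ map (next G) (range 1 (length T + suc (length S)))
      ≡⟨ cong (λ L → next G 1 ∷ map (next G) L) (range-++ 1 (length T) (suc (length S))) ⟩
    next G 1 ∷ map (next G) (range 1 (length T) ++ range α (suc (length S)))
      ≡⟨ cong (next G 1 ∷_) (map-++ (next G) (range 1 (length T)) _) ⟩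
    next G 1 ∷ map (next G) (range 1 (length T)) ++ map (next G) (range α (suc (length S)))
      ≡⟨ cong₂ (λ u v → u ∷ v) (+-comm α 1) (cong₂ _++_ left right) ⟩
    suc α ∷ r ++ map (relabel h α) σ
      ≡⟨ cong (λ L → suc (suc L) ∷ r ++ map (relabel h (suc L)) σ) length-r ⟨
    glueOneLine (oneLine (1 ∷ T)) σ ∎
    where
    open ≡-Reasoning
    length-M++T : length (M ++ T) ≡ length T + suc (length S)
    length-M++T = trans (length-++ M) (trans (cong (_+ length T) (length-map (_+_ α) (1 ∷ S))) (+-comm (suc (length S)) (length T)))
    left : map (next G) (range 1 (length T)) ≡ r
    left = map-cong-local (All.tabulate next-left)
    right : map (next G) (range α (suc (length S))) ≡ map (relabel h α) σ
    right = begin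
      map (next G) (range α (suc (length S)))                 ≡⟨ cong (map (next G)) (range-shift α (suc (length S))) ⟩
      map (next G) (map (_+_ α) (range 0 (suc (length S))))    ≡⟨ map-∘ (range 0 (suc (length S))) ⟨
      map (next G ∘ (_+_ α)) (range 0 (suc (length S)))        ≡⟨ map-cong-local (All.tabulate next-right) ⟩
      map (relabel h α ∘ next (1 ∷ S)) (range 0 (suc (length S))) ≡⟨ map-∘ (range 0 (suc (length S))) ⟩
      map (relabel h α) σ                                     ∎


-- Decomposing 213-avoiding cycle words

spanAbove : ∀ c w → ∃[ B ] ∃[ T ] (w ≡ B ++ T × All (c <_) B × All (λ t → ¬ c < t) (take 1 T))
spanAbove c [] = [] , [] , refl , [] , []
spanAbove c (x ∷ w) with c <? x
... | yes c<x = let B , T , e , B>c , T₀ = spanAbove c w in x ∷ B , T , cong (x ∷_) e , c<x ∷ B>c , T₀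
... | no c≮x = [] , x ∷ w , refl , [] , c≮x ∷ []

below-after-drop : ∀ c B T → All (λ t → ¬ c < t) (take 1 T) → All (c ≢_) T → ¬ Has213 (c ∷ B ++ T) → All (_< c) T
below-after-drop c B [] _ _ _ = []
below-after-drop c B (t ∷ T) (c≮t ∷ []) (c≢t ∷ c∉T) ¬213 =
  t<c ∷ All.zipWith (λ (c≢y , y∈) → ≤∧≢⇒< (≮⇒≥ λ c<y → ¬213 (c , t , _ , refl ∷ ++⁺ˡ B (refl ∷ from∈ y∈) , t<c , c<y))
                                            (c≢y ∘ sym))
                     (c∉T , All.tabulate id)
  where
  t<c : t < c
  t<c = ≤∧≢⇒< (≮⇒≥ c≮t) (c≢t ∘ sym)

-- C = 1, α + 1, B, T where B are the entries above α + 1 that follow it directly. Avoiding 213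
-- forces T below α + 1; then (1 T) and (1, B shifted down by α) are 213-avoiding cycle words.
module Decompose {m α : ℕ} {B T : List ℕ} (V : IsCycle213 (2 + m) (1 ∷ suc α ∷ B ++ T)) (α≥1 : 1 ≤ α)
                 (B>c : All (suc α <_) B) (T<c : All (_< suc α) T) where

  n : ℕ
  n = 2 + m

  C : List ℕ
  C = 1 ∷ suc α ∷ B ++ T

  S : List ℕ
  S = map (_∸ α) B

  inRange : ∀ {x} → x ∈ C → InRange n x
  inRange = All.lookup (proj₂ (proj₂ (proj₁ V)))

  cases : ∀ {x} → InRange n x → x ≡ 1 ⊎ x ≡ suc α ⊎ x ∈ B ⊎ x ∈ T
  cases x-inR with IsPerm⇒∈ (proj₁ V) x-inR
  ... | here e = inj₁ e
  ... | there (here e) = inj₂ (inj₁ e)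
  ... | there (there x∈) = inj₂ (inj₂ (∈-++⁻ B x∈))

  α≤ : α ≤ suc m
  α≤ = ≤-pred (proj₂ (inRange (there (here refl))))

  T⊆C : 1 ∷ T ⊆ C
  T⊆C = refl ∷ (_ ∷ʳ ++⁺ˡ B ⊆-refl)

  B⊆C : suc α ∷ B ⊆ C
  B⊆C = 1 ∷ʳ (refl ∷ ++⁺ʳ T ⊆-refl)

  τ-IsPerm : IsPerm α (1 ∷ T)
  τ-IsPerm = IsPerm-fromMembership (AllPairs-resp-⊆ T⊆C (proj₁ (proj₁ V))) members complete
    where
    members : ∀ {x} → x ∈ 1 ∷ T → InRange α x
    members (here refl) = ≤-refl , α≥1
    members (there x∈) = proj₁ (inRange (lookup T⊆C (there x∈))) , ≤-pred (All.lookup T<c x∈)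
    complete : ∀ {x} → InRange α x → x ∈ 1 ∷ T
    complete (x≥1 , x≤α) with cases (x≥1 , ≤-trans x≤α (≤-trans α≤ (n≤1+n _)))
    ... | inj₁ refl = here refl
    ... | inj₂ (inj₁ refl) = contradiction x≤α (<-irrefl refl ∘ s≤s)
    ... | inj₂ (inj₂ (inj₁ x∈B)) = contradiction (<-trans (n<1+n α) (All.lookup B>c x∈B)) (≤⇒≯ x≤α)
    ... | inj₂ (inj₂ (inj₂ x∈T)) = there x∈T

  α+[x∸α] : ∀ {x} → x ∈ B → α + (x ∸ α) ≡ x
  α+[x∸α] x∈ = m+[n∸m]≡n (≤-trans (n≤1+n α) (<⇒≤ (All.lookup B>c x∈)))

  B≡ : map (_+_ α) S ≡ B
  B≡ = trans (sym (map-∘ B)) (trans (map-cong-local (All.tabulate α+[x∸α])) (map-id B))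

  σ-IsPerm : IsPerm (n ∸ α) (1 ∷ S)
  σ-IsPerm = IsPerm-fromMembership unique members complete
    where
    S≥2 : ∀ {y} → y ∈ S → 2 ≤ y × y ≤ n ∸ α
    S≥2 y∈ with x , x∈ , refl ← ∈-map⁻ (_∸ α) y∈ =
      +-cancelˡ-≤ α 2 (x ∸ α)
        (subst (_≤ α + (x ∸ α)) (+-comm 2 α) (subst (2 + α ≤_) (sym (α+[x∸α] x∈)) (All.lookup B>c x∈))) ,
      ∸-monoˡ-≤ α (proj₂ (inRange (lookup B⊆C (there x∈))))
    unique : Unique (1 ∷ S)
    unique = All.tabulate (λ y∈ 1≡y → <⇒≱ (proj₁ (S≥2 y∈)) (≤-reflexive (sym 1≡y)))
           ∷ Unique-map⁺ (_∸ α) (λ x∈ x′∈ e → trans (sym (α+[x∸α] x∈)) (trans (cong (_+_ α) e) (α+[x∸α] x′∈)))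
                         (AllPairs-resp-⊆ (++⁺ʳ T ⊆-refl) (AllPairs.tail (AllPairs.tail (proj₁ (proj₁ V)))))
    members : ∀ {y} → y ∈ 1 ∷ S → InRange (n ∸ α) y
    members (here refl) = ≤-refl , subst (1 ≤_) (sym (+-∸-assoc 1 α≤)) (s≤s z≤n)
    members (there y∈) = let y≥2 , y≤ = S≥2 y∈ in <⇒≤ y≥2 , y≤
    complete : ∀ {y} → InRange (n ∸ α) y → y ∈ 1 ∷ S
    complete {y} (y≥1 , y≤) with y ≟ 1
    ... | yes refl = here refl
    ... | no y≢1 with cases (≤-trans α≥1 (m≤m+n α y) ,
                             subst (α + y ≤_) (m+[n∸m]≡n (≤-trans α≤ (n≤1+n _))) (+-monoʳ-≤ α y≤))
    ...   | inj₁ α+y≡1 = contradiction α+y≡1 (<⇒≢ (+-mono-≤ α≥1 y≥1) ∘ sym)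
    ...   | inj₂ (inj₁ α+y≡c) = contradiction (+-cancelˡ-≡ α y 1 (trans α+y≡c (+-comm 1 α))) y≢1
    ...   | inj₂ (inj₂ (inj₂ α+y∈T)) =
      contradiction (All.lookup T<c α+y∈T) (≤⇒≯ (subst (_≤ α + y) (+-comm α 1) (+-monoʳ-≤ α y≥1)))
    ...   | inj₂ (inj₂ (inj₁ α+y∈B)) = there (subst (_∈ S) (m+n∸m≡n α y) (∈-map⁺ (_∸ α) α+y∈B))

  glue≡ : glue (1 ∷ T) (1 ∷ S) ≡ C
  glue≡ = trans (cong (λ a → 1 ∷ map (_+_ a) (1 ∷ S) ++ T) (proj₁ (proj₂ τ-IsPerm)))
                (cong (1 ∷_) (cong₂ (λ u v → u ∷ v ++ T) (+-comm α 1) B≡))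

  τ-IsCycle213 : IsCycle213 α (1 ∷ T)
  τ-IsCycle213 = τ-IsPerm , refl , proj₂ (proj₂ V) ∘ Has213-resp-⊆ T⊆C

  σ-IsCycle213 : IsCycle213 (n ∸ α) (1 ∷ S)
  σ-IsCycle213 = σ-IsPerm , refl ,
    proj₂ (proj₂ V) ∘ Has213-resp-⊆ B⊆C ∘ subst Has213 (cong₂ _∷_ (+-comm α 1) B≡) ∘
    Equivalence.from (Has213-shift α (1 ∷ S))

Decomposition : ℕ → List ℕ → Set
Decomposition m C = ∃[ a ] ∃[ T ] ∃[ S ]
  ((1 ≤ a × a ≤ suc m) × IsCycle213 a (1 ∷ T) × IsCycle213 (2 + m ∸ a) (1 ∷ S) × C ≡ glue (1 ∷ T) (1 ∷ S))

decompose : ∀ m {C} → IsCycle213 (2 + m) C → Decomposition m C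
decompose m {[]} ((_ , () , _) , _)
decompose m {_ ∷ []} ((_ , () , _) , _)
decompose m {_ ∷ 0 ∷ _} ((_ , _ , _ ∷ (() , _) ∷ _) , _)
decompose m {_ ∷ 1 ∷ _} (((1∉ ∷ _) , _) , refl , _) = contradiction refl (All.head 1∉)
decompose m {1 ∷ c@(suc (suc α′)) ∷ w} V@((_ ∷ c∉ ∷ _ , _) , refl , ¬213)
  with B , T , refl , B>c , T₀ ← spanAbove c w =
  suc α′ , T , S , (s≤s z≤n , α≤) , τ-IsCycle213 , σ-IsCycle213 , sym glue≡
  where
  T<c : All (_< c) T
  T<c = below-after-drop c B T T₀ (All.++⁻ʳ B c∉) (¬213 ∘ Has213-resp-⊆ (1 ∷ʳ ⊆-refl))
  open Decompose V (s≤s z≤n) B>c T<c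

-- The first argument is fuel: cycles213′ f n lists all of them as soon as n ≤ f.
cycles213′ : ℕ → ℕ → List (List ℕ)
glueAll : ℕ → ℕ → ℕ → List (List ℕ)

cycles213′ zero _ = []
cycles213′ (suc f) zero = []
cycles213′ (suc f) 1 = [ [ 1 ] ]
cycles213′ (suc f) (suc (suc m)) = concatMap (glueAll f (2 + m)) (range 0 (suc m))

glueAll f n a = concatMap (λ Cτ → map (glue Cτ) (cycles213′ f (n ∸ a))) (cycles213′ f a)

cycles213 : ℕ → List (List ℕ)
cycles213 n = cycles213′ n n

IsCycle213-shape : ∀ {n C} → IsCycle213 n C → ∃[ T ] C ≡ 1 ∷ T
IsCycle213-shape {C = _ ∷ T} (_ , refl , _) = T , refl

IsCycle213-[1] : IsCycle213 1 [ 1 ]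
IsCycle213-[1] =
  ([] ∷ [] , refl , (≤-refl , ≤-refl) ∷ []) , refl , λ (_ , _ , _ , t⊆ , _) → ≤⇒≯ (length-mono-≤ t⊆) (s≤s (s≤s z≤n))

∈-glueAll⁻ : ∀ {f} → (∀ {a C} → C ∈ cycles213′ f a → IsCycle213 a C) → ∀ {n a π} → π ∈ glueAll f n a →
             ∃[ T ] ∃[ S ] (IsCycle213 a (1 ∷ T) × IsCycle213 (n ∸ a) (1 ∷ S) × π ≡ glue (1 ∷ T) (1 ∷ S))
∈-glueAll⁻ {f} sound {n} {a} π∈ with Cτ , Cτ∈ , π∈′ ← ∈-concatMap⁻ _ (cycles213′ f a) π∈
  with Cσ , Cσ∈ , refl ← ∈-map⁻ (glue Cτ) π∈′
  with T , refl ← IsCycle213-shape (sound Cτ∈) | S , refl ← IsCycle213-shape (sound Cσ∈) =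
  T , S , sound Cτ∈ , sound Cσ∈ , refl

cycles213′-sound : ∀ f {n C} → C ∈ cycles213′ f n → IsCycle213 n C
cycles213′-sound (suc f) {1} (here refl) = IsCycle213-[1]
cycles213′-sound (suc f) {suc (suc m)} C∈ with a , a∈ , C∈′ ← ∈-concatMap⁻ (glueAll f (2 + m)) (range 0 (suc m)) C∈
  with T , S , Vτ , Vσ , refl ← ∈-glueAll⁻ {f} (cycles213′-sound f) {2 + m} {a} C∈′ =
  subst (λ v → IsCycle213 v (glue (1 ∷ T) (1 ∷ S))) (m+[n∸m]≡n (≤-trans (proj₂ (∈-range⁻ 0 (suc m) a∈)) (n≤1+n _)))
        (GlueWords.glue-IsCycle213 (proj₁ Vτ) (proj₁ Vσ) (proj₂ (proj₂ Vτ)) (proj₂ (proj₂ Vσ)))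

cycles213′-complete : ∀ f {n C} → n ≤ f → IsCycle213 n C → C ∈ cycles213′ f n
cycles213′-complete f {0} {[]} _ (_ , () , _)
cycles213′-complete f {0} {_ ∷ _} _ ((_ , () , _) , _)
cycles213′-complete (suc f) {1} {_ ∷ []} _ (_ , refl , _) = here refl
cycles213′-complete (suc f) {1} {_ ∷ _ ∷ _} _ ((_ , () , _) , _)
cycles213′-complete (suc f) {suc (suc m)} (s≤s n≤f) V with a , T , S , (a≥1 , a≤) , Vτ , Vσ , refl ← decompose m V =
  ∈-concatMap⁺ (glueAll f (2 + m)) (∈-range⁺ 0 (suc m) a≥1 a≤)
    (∈-concatMap⁺ (λ Cτ → map (glue Cτ) (cycles213′ f (2 + m ∸ a))) (cycles213′-complete f (≤-trans a≤ n≤f) Vτ)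
      (∈-map⁺ (glue (1 ∷ T)) (cycles213′-complete f (≤-trans (∸-monoʳ-≤ (2 + m) a≥1) n≤f) Vσ)))

glue-injective : ∀ T S T′ S′ → glue (1 ∷ T) (1 ∷ S) ≡ glue (1 ∷ T′) (1 ∷ S′) → T ≡ T′ × S ≡ S′
glue-injective T S T′ S′ e = proj₂ split , map-injective (+-cancelˡ-≡ (suc (length T)) _ _) (proj₁ split)
  where
  lengths : length T ≡ length T′
  lengths = suc-injective (+-cancelʳ-≡ 1 (suc (length T)) (suc (length T′)) (∷-injectiveˡ (∷-injectiveʳ e)))
  e′ : map (_+_ (suc (length T))) S ++ T ≡ map (_+_ (suc (length T))) S′ ++ T′
  e′ = trans (∷-injectiveʳ (∷-injectiveʳ e)) (cong (λ l → map (_+_ (suc l)) S′ ++ T′) (sym lengths))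
  split : map (_+_ (suc (length T))) S ≡ map (_+_ (suc (length T))) S′ × T ≡ T′
  split = ++-injective e′ (+-cancelʳ-≡ (length T) _ _ (trans (sym (length-++ (map _ S))) (trans (cong length e′)
            (trans (length-++ (map _ S′)) (cong (_+_ (length (map _ S′))) (sym lengths))))))
    where
    ++-injective : ∀ {xs xs′ ys ys′ : List ℕ} → xs ++ ys ≡ xs′ ++ ys′ → length xs ≡ length xs′ →
                   xs ≡ xs′ × ys ≡ ys′
    ++-injective {[]} {[]} e _ = refl , e
    ++-injective {x ∷ xs} {x′ ∷ xs′} e l with ++-injective {xs} {xs′} (∷-injectiveʳ e) (suc-injective l)
    ... | refl , e₂ = cong (_∷ xs) (∷-injectiveˡ e) , e₂

glue-injectiveʳ : ∀ Cτ {Cσ Cσ′} → glue Cτ Cσ ≡ glue Cτ Cσ′ → Cσ ≡ Cσ′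
glue-injectiveʳ Cτ e = map-injective (+-cancelˡ-≡ (length Cτ) _ _) (++-cancelʳ (drop 1 Cτ) _ _ (∷-injectiveʳ e))

cycles213′-unique : ∀ f n → Unique (cycles213′ f n)
cycles213′-unique zero n = []
cycles213′-unique (suc f) zero = []
cycles213′-unique (suc f) 1 = [] ∷ []
cycles213′-unique (suc f) (suc (suc m)) =
  Unique-concatMap⁺ (glueAll f n) (range-unique 0 (suc m)) (λ _ → glueAll-unique) same-size
  where
  n : ℕ
  n = 2 + m
  sound : ∀ {a C} → C ∈ cycles213′ f a → IsCycle213 a C
  sound = cycles213′-sound f
  glueAll-unique : ∀ {a} → Unique (glueAll f n a)
  glueAll-unique {a} = Unique-concatMap⁺ (λ Cτ → map (glue Cτ) (cycles213′ f (n ∸ a))) (cycles213′-unique f a)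
    (λ {Cτ} _ → Unique.map⁺ (glue-injectiveʳ Cτ) (cycles213′-unique f (n ∸ a)))
    λ Cτ∈ Cτ′∈ π∈ π∈′ → case Cτ∈ Cτ′∈ (∈-map⁻ _ π∈) (∈-map⁻ _ π∈′)
    where
    case : ∀ {Cτ Cτ′ π} → Cτ ∈ cycles213′ f a → Cτ′ ∈ cycles213′ f a →
           ∃[ Cσ ] (Cσ ∈ cycles213′ f (n ∸ a) × π ≡ glue Cτ Cσ) →
           ∃[ Cσ ] (Cσ ∈ cycles213′ f (n ∸ a) × π ≡ glue Cτ′ Cσ) → Cτ ≡ Cτ′
    case Cτ∈ Cτ′∈ (Cσ , Cσ∈ , refl) (Cσ′ , Cσ′∈ , e)
      with T , refl ← IsCycle213-shape (sound Cτ∈) | T′ , refl ← IsCycle213-shape (sound Cτ′∈)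
         | S , refl ← IsCycle213-shape (sound Cσ∈) | S′ , refl ← IsCycle213-shape (sound Cσ′∈) =
      cong (1 ∷_) (proj₁ (glue-injective T S T′ S′ e))
  same-size : ∀ {a a′ π} → a ∈ range 0 (suc m) → a′ ∈ range 0 (suc m) →
              π ∈ glueAll f n a → π ∈ glueAll f n a′ → a ≡ a′
  same-size {a} {a′} _ _ π∈ π∈′ with ∈-glueAll⁻ {f} sound {n} {a} π∈ | ∈-glueAll⁻ {f} sound {n} {a′} π∈′
  ... | T , S , Vτ , _ , refl | T′ , S′ , Vτ′ , _ , e =
    trans (sym (proj₁ (proj₂ (proj₁ Vτ))))
          (trans (cong (length ∘ (1 ∷_)) (proj₁ (glue-injective T S T′ S′ e))) (proj₁ (proj₂ (proj₁ Vτ′))))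

count : ∀ {A : Set} → (A → Bool) → List A → ℕ
count p xs = length (filter (λ x → p x ≟ᵇ true) xs)

∈-count⁻ : ∀ {A : Set} (p : A → Bool) {xs x} → x ∈ filter (λ x → p x ≟ᵇ true) xs → x ∈ xs × p x ≡ true
∈-count⁻ p = ∈-filter⁻ (λ x → p x ≟ᵇ true)

∈-count⁺ : ∀ {A : Set} (p : A → Bool) {xs x} → x ∈ xs → p x ≡ true → x ∈ filter (λ x → p x ≟ᵇ true) xs
∈-count⁺ p = ∈-filter⁺ (λ x → p x ≟ᵇ true)

Unique-count : ∀ {A : Set} (p : A → Bool) {xs} → Unique xs → Unique (filter (λ x → p x ≟ᵇ true) xs)
Unique-count p = Unique.filter⁺ (λ x → p x ≟ᵇ true)

count-++ : ∀ {A : Set} (p : A → Bool) xs ys → count p (xs ++ ys) ≡ count p xs + count p ys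
count-++ p xs ys = trans (cong length (filter-++ (λ x → p x ≟ᵇ true) xs ys)) (length-++ (filter _ xs))

count-concatMap : ∀ {A B : Set} (p : B → Bool) (g : A → List B) L → count p (concatMap g L) ≡ sum (map (count p ∘ g) L)
count-concatMap p g [] = refl
count-concatMap p g (x ∷ L) = trans (count-++ p (g x) (concatMap g L)) (cong (_+_ (count p (g x))) (count-concatMap p g L))

count-map-∧ : ∀ {A B : Set} (p : B → Bool) (g : A → B) b (q : A → Bool) L →
              (∀ {y} → y ∈ L → p (g y) ≡ b ∧ q y) → count p (map g L) ≡ (if b then count q L else 0)
count-map-∧ p g false q [] _ = refl
count-map-∧ p g true q [] _ = refl
count-map-∧ p g b q (y ∷ L) h rewrite h (here refl) with b | q y | count-map-∧ p g b q L (h ∘ there)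
... | true  | true  | ih = cong suc ih
... | true  | false | ih = ih
... | false | _     | ih = ih

sum-if : ∀ {A : Set} (q : A → Bool) c L → sum (map (λ x → if q x then c else 0) L) ≡ count q L * c
sum-if q c [] = refl
sum-if q c (x ∷ L) with q x
... | true = cong (_+_ c) (sum-if q c L)
... | false = sum-if q c L

sum-map-+ : ∀ {A : Set} (f g : A → ℕ) L → sum (map (λ a → f a + g a) L) ≡ sum (map f L) + sum (map g L)
sum-map-+ f g [] = refl
sum-map-+ f g (x ∷ L) = trans (cong (_+_ (f x + g x)) (sum-map-+ f g L)) (+-interchange (f x) (g x) _ _)

sum-cong : ∀ {A : Set} {f g : A → ℕ} L → (∀ {x} → x ∈ L → f x ≡ g x) → sum (map f L) ≡ sum (map g L)
sum-cong L f≗g = cong sum (map-cong-local (All.tabulate f≗g))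

statL : ℕ → List ℕ → Bool
statL k C = avoidsδ k (oneLine C)

counted : ℕ → List ℕ → Bool
counted k π = isCyclic π ∧ avoidsᵇ (δ k) π ∧ avoidsᵇ p213 (cycleForm π)

-- Cyclic permutations with 213-avoiding cycle form are exactly the one-line forms of 213-avoiding cycle words.
module CycleCorrespondence (n k : ℕ) where

  W : List (List ℕ)
  W = cycles213 (suc n)

  W-sound : ∀ {C} → C ∈ W → IsCycle213 (suc n) C
  W-sound = cycles213′-sound (suc n)

  countedPerms : List (List ℕ)
  countedPerms = filter (λ π → counted k π ≟ᵇ true) (perms (suc n))

  images : List (List ℕ)
  images = map oneLine (filter (λ C → statL k C ≟ᵇ true) W)

  images-unique : Unique images
  images-unique = Unique-map⁺ oneLine
    (λ C∈ D∈ → oneLine-injective (W-sound (proj₁ (∈-count⁻ (statL k) C∈))) (W-sound (proj₁ (∈-count⁻ (statL k) D∈))))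
    (Unique-count (statL k) (cycles213′-unique (suc n) (suc n)))
    where
    oneLine-injective : ∀ {C D} → IsCycle213 (suc n) C → IsCycle213 (suc n) D → oneLine C ≡ oneLine D → C ≡ D
    oneLine-injective V V′ e with T , refl ← IsCycle213-shape V | T′ , refl ← IsCycle213-shape V′ =
      trans (sym (cycleForm-oneLine (proj₁ V))) (trans (cong cycleForm e) (cycleForm-oneLine (proj₁ V′)))

  counted⇒image : ∀ {π} → π ∈ countedPerms → π ∈ images
  counted⇒image {π} π∈ with π∈perms , c ← ∈-count⁻ (counted k) π∈ =
    subst (_∈ images) π≡ (∈-map⁺ oneLine (∈-count⁺ (statL k) (cycles213′-complete (suc n) ≤-refl V)
                                                             (trans (cong (avoidsδ k) π≡) avoids-δ)))
    where
    P : IsPerm (suc n) π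
    P = perms-sound (suc n) π∈perms
    cyclic : isCyclic π ≡ true
    cyclic = ∧-conicalˡ _ _ c
    avoids-δ : avoidsδ k π ≡ true
    avoids-δ = ∧-conicalˡ _ _ (∧-conicalʳ (isCyclic π) _ c)
    V : IsCycle213 (suc n) (cycleForm π)
    V = CycleForm.IsPerm-C P cyclic ,
        head-cycleForm π (subst (1 ≤_) (sym (proj₁ (proj₂ P))) (s≤s z≤n)) ,
        Equivalence.to (avoids213⇔¬Has213 (cycleForm π)) (∧-conicalʳ (avoidsδ k π) _ (∧-conicalʳ (isCyclic π) _ c))
    π≡ : oneLine (cycleForm π) ≡ π
    π≡ = oneLine-cycleForm P cyclic

  image⇒counted : ∀ {π} → π ∈ images → π ∈ countedPerms
  image⇒counted π∈ with C , C∈ , refl ← ∈-map⁻ oneLine π∈ with C∈W , avoids-δ ← ∈-count⁻ (statL k) C∈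
    with V@(P , _ , ¬213) ← W-sound C∈W with T , refl ← IsCycle213-shape V =
    ∈-count⁺ (counted k) (perms-complete (suc n) (oneLine-IsPerm P)) is-counted
    where
    ∧³-true : ∀ {x y z} → x ≡ true → y ≡ true → z ≡ true → x ∧ y ∧ z ≡ true
    ∧³-true refl refl refl = refl
    is-counted : counted k (oneLine (1 ∷ T)) ≡ true
    is-counted = subst (λ D → distinctᵇ D ∧ avoidsδ k (oneLine (1 ∷ T)) ∧ avoidsᵇ p213 D ≡ true) (sym (cycleForm-oneLine P))
                       (∧³-true (Equivalence.from (distinctᵇ⇔Unique _) (proj₁ P)) avoids-δ
                                (Equivalence.from (avoids213⇔¬Has213 _) ¬213))

a≡count : ∀ n k → a (suc n) k ≡ count (statL k) (cycles213 (suc n))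
a≡count n k =
  trans (Unique-≐⇒length-≡ (Unique-count (counted k) (perms-unique (suc n))) images-unique counted⇒image image⇒counted)
        (length-map oneLine (filter (λ C → statL k C ≟ᵇ true) W))
  where open CycleCorrespondence n k

countCycles : (List ℕ → Bool) → ℕ → ℕ
countCycles p n = count p (cycles213 n)

count-fuel : ∀ (q : List ℕ → Bool) {f n} → n ≤ f → count q (cycles213′ f n) ≡ countCycles q n
count-fuel q {f} {n} n≤f =
  Unique-≐⇒length-≡ (Unique-count q (cycles213′-unique f n)) (Unique-count q (cycles213′-unique n n))
                    (move {f} {n} ≤-refl) (move {n} {f} n≤f)
  where
  move : ∀ {f f′} → n ≤ f′ → ∀ {C} → C ∈ filter (λ C → q C ≟ᵇ true) (cycles213′ f n) →
                                     C ∈ filter (λ C → q C ≟ᵇ true) (cycles213′ f′ n)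
  move {f} {f′} n≤f′ C∈ with C∈′ , qC ← ∈-count⁻ q C∈ =
    ∈-count⁺ q (cycles213′-complete f′ n≤f′ (cycles213′-sound f C∈′)) qC

count-glue : ∀ m (p : List ℕ → Bool) (p₁ p₂ : ℕ → List ℕ → Bool) →
             (∀ {a T S} → IsCycle213 a (1 ∷ T) → IsCycle213 (2 + m ∸ a) (1 ∷ S) →
                          p (glue (1 ∷ T) (1 ∷ S)) ≡ p₁ a (1 ∷ T) ∧ p₂ a (1 ∷ S)) →
             countCycles p (2 + m) ≡ sum (map (λ a → countCycles (p₁ a) a * countCycles (p₂ a) (2 + m ∸ a)) (range 0 (suc m)))
count-glue m p p₁ p₂ law =
  trans (count-concatMap p (glueAll (suc m) n) (range 0 (suc m))) (sum-cong (range 0 (suc m)) count-glueAll)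
  where
  open ≡-Reasoning
  n : ℕ
  n = 2 + m
  count-glueAll : ∀ {a} → a ∈ range 0 (suc m) → count p (glueAll (suc m) n a) ≡ countCycles (p₁ a) a * countCycles (p₂ a) (n ∸ a)
  count-glueAll {a} a∈ with a≥1 , a≤ ← ∈-range⁻ 0 (suc m) a∈ = begin
    count p (glueAll (suc m) n a)
      ≡⟨ count-concatMap p (λ Cτ → map (glue Cτ) W₂) W₁ ⟩
    sum (map (λ Cτ → count p (map (glue Cτ) W₂)) W₁)
      ≡⟨ sum-cong W₁ (λ {Cτ} Cτ∈ → count-map-∧ p (glue Cτ) (p₁ a Cτ) (p₂ a) W₂ (law′ Cτ∈)) ⟩
    sum (map (λ Cτ → if p₁ a Cτ then count (p₂ a) W₂ else 0) W₁)
      ≡⟨ sum-if (p₁ a) (count (p₂ a) W₂) W₁ ⟩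
    count (p₁ a) W₁ * count (p₂ a) W₂
      ≡⟨ cong₂ _*_ (count-fuel (p₁ a) a≤) (count-fuel (p₂ a) (∸-monoʳ-≤ n a≥1)) ⟩
    countCycles (p₁ a) a * countCycles (p₂ a) (n ∸ a) ∎
    where
    W₁ W₂ : List (List ℕ)
    W₁ = cycles213′ (suc m) a
    W₂ = cycles213′ (suc m) (n ∸ a)
    law′ : ∀ {Cτ Cσ} → Cτ ∈ W₁ → Cσ ∈ W₂ → p (glue Cτ Cσ) ≡ p₁ a Cτ ∧ p₂ a Cσ
    law′ Cτ∈ Cσ∈ with Vτ ← cycles213′-sound (suc m) {a} Cτ∈ | Vσ ← cycles213′-sound (suc m) {n ∸ a} Cσ∈
      with T , refl ← IsCycle213-shape Vτ | S , refl ← IsCycle213-shape Vσ = law Vτ Vσ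

-- Four statistics and their recurrences

statD statM statE : ℕ → List ℕ → Bool
statD k C = avoidsδ k (headToEnd (oneLine C))
statM k C = avoidsδ k (delete 1 (oneLine C))
statE k C = avoidsδ k (headToEnd∖1 (oneLine C))

IsPerm⇒Glueable : ∀ {a b h r σ} → IsPerm a (h ∷ r) → IsPerm b σ → 1 ≤ b → Glueable h r σ
IsPerm⇒Glueable (_ , refl , (_ , h≤) ∷ r-inR) Pσ@(_ , refl , σ-inR) b≥1 = record
  { h≤α = h≤
  ; r≤α = All.map proj₂ r-inR
  ; σ≥1 = All.map proj₁ σ-inR
  ; σ≤b = All.map proj₂ σ-inR
  ; 1∈σ = IsPerm⇒∈ Pσ (≤-refl , b≥1)
  }

module GlueStatistics {a b : ℕ} {T S : List ℕ} (Vτ : IsCycle213 a (1 ∷ T)) (Vσ : IsCycle213 b (1 ∷ S)) where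

  oneLine-G : oneLine (glue (1 ∷ T) (1 ∷ S)) ≡ glueOneLine (oneLine (1 ∷ T)) (oneLine (1 ∷ S))
  oneLine-G = GlueWords.oneLine-glue (proj₁ Vτ) (proj₁ Vσ)

  glueable : Glueable (next (1 ∷ T) 1) (map (next (1 ∷ T)) (range 1 (length T))) (oneLine (1 ∷ S))
  glueable = IsPerm⇒Glueable (oneLine-IsPerm (proj₁ Vτ)) (oneLine-IsPerm (proj₁ Vσ))
                             (subst (1 ≤_) (proj₁ (proj₂ (proj₁ Vσ))) (s≤s z≤n))

  statL-glue : ∀ k → statL k (glue (1 ∷ T) (1 ∷ S)) ≡ statD k (1 ∷ T) ∧ statL k (1 ∷ S)
  statL-glue k = trans (cong (avoidsδ k) oneLine-G) (GlueLaws.avoids-L glueable k)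

  statD-glue : ∀ k → statD k (glue (1 ∷ T) (1 ∷ S)) ≡ statD k (1 ∷ T) ∧ statM (k ∸ 2) (1 ∷ S)
  statD-glue k = trans (cong (avoidsδ k ∘ headToEnd) oneLine-G) (GlueLaws.avoids-D glueable k)

second≢1 : ∀ {a t T} → IsCycle213 a (1 ∷ t ∷ T) → t ≢ 1
second≢1 (((1∉ ∷ _) , _) , _) t≡1 = All.head 1∉ (sym t≡1)

statE-glue : ∀ {a b T S} k → IsCycle213 a (1 ∷ T) → IsCycle213 b (1 ∷ S) →
             statE k (glue (1 ∷ T) (1 ∷ S)) ≡ statE k (1 ∷ T) ∧ statM (k ∸ 2) (1 ∷ S)
statE-glue {T = []} k Vτ Vσ =
  trans (cong (avoidsδ k ∘ headToEnd∖1) oneLine-G) (GlueLaws₁.avoids-E glueable k)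
  where open GlueStatistics Vτ Vσ
statE-glue {T = t ∷ T} k Vτ Vσ =
  trans (cong (avoidsδ k ∘ headToEnd∖1) oneLine-G) (GlueLaws.avoids-E glueable (second≢1 Vτ) k)
  where open GlueStatistics Vτ Vσ

-- For a = 1, deleting 1 from the glued word leaves 2 followed by σ ∖ 1 shifted up, which behaves like [1] ++ σ ∖ 1.
statMˡ statMʳ : ℕ → ℕ → List ℕ → Bool
statMˡ k a = if a ≡ᵇ 1 then statL k else statE k
statMʳ k a = if a ≡ᵇ 1 then statM k else statL k

statM-glue : ∀ {a b T S} k → IsCycle213 a (1 ∷ T) → IsCycle213 b (1 ∷ S) →
             statM k (glue (1 ∷ T) (1 ∷ S)) ≡ statMˡ k a (1 ∷ T) ∧ statMʳ k a (1 ∷ S)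
statM-glue {T = []} k Vτ@((_ , refl , _) , _) Vσ =
  trans (cong (avoidsδ k ∘ delete 1) oneLine-G) (GlueLaws₁.avoids-M glueable k)
  where open GlueStatistics Vτ Vσ
statM-glue {T = t ∷ T} k Vτ@((_ , refl , _) , _) Vσ =
  trans (cong (avoidsδ k ∘ delete 1) oneLine-G) (GlueLaws.avoids-M glueable (second≢1 Vτ) k)
  where open GlueStatistics Vτ Vσ

convolution : (ℕ → ℕ) → (ℕ → ℕ) → ℕ → ℕ
convolution x y m = sum (map (λ a → x a * y (2 + m ∸ a)) (range 0 (suc m)))

recurrence-L : ∀ k m → countCycles (statL k) (2 + m) ≡ convolution (countCycles (statD k)) (countCycles (statL k)) m
recurrence-L k m = count-glue m (statL k) (λ _ → statD k) (λ _ → statL k) λ Vτ Vσ → GlueStatistics.statL-glue Vτ Vσ k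

recurrence-D : ∀ k m → countCycles (statD k) (2 + m) ≡ convolution (countCycles (statD k)) (countCycles (statM (k ∸ 2))) m
recurrence-D k m = count-glue m (statD k) (λ _ → statD k) (λ _ → statM (k ∸ 2)) λ Vτ Vσ → GlueStatistics.statD-glue Vτ Vσ k

recurrence-E : ∀ k m → countCycles (statE k) (2 + m) ≡ convolution (countCycles (statE k)) (countCycles (statM (k ∸ 2))) m
recurrence-E k m = count-glue m (statE k) (λ _ → statE k) (λ _ → statM (k ∸ 2)) λ Vτ Vσ → statE-glue k Vτ Vσ

atOne : ℕ → ℕ → ℕ
atOne c a = if a ≡ᵇ 1 then c else 0

offOne : (ℕ → ℕ) → ℕ → ℕ
offOne x a = if a ≡ᵇ 1 then 0 else x a

recurrence-M : ∀ k m → countCycles (statM k) (2 + m) ≡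
               convolution (atOne (countCycles (statL k) 1)) (countCycles (statM k)) m +
               convolution (offOne (countCycles (statE k))) (countCycles (statL k)) m
recurrence-M k m = begin
  countCycles (statM k) n
    ≡⟨ count-glue m (statM k) (statMˡ k) (statMʳ k) (λ Vτ Vσ → statM-glue k Vτ Vσ) ⟩
  sum (map (λ a → countCycles (statMˡ k a) a * countCycles (statMʳ k a) (n ∸ a)) (range 0 (suc m)))
    ≡⟨ sum-cong (range 0 (suc m)) (λ {a} _ → split a) ⟩
  sum (map (λ a → atOne (countCycles (statL k) 1) a * countCycles (statM k) (n ∸ a) +
                  offOne (countCycles (statE k)) a * countCycles (statL k) (n ∸ a)) (range 0 (suc m)))
    ≡⟨ sum-map-+ (λ a → atOne (countCycles (statL k) 1) a * countCycles (statM k) (n ∸ a))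
                 (λ a → offOne (countCycles (statE k)) a * countCycles (statL k) (n ∸ a)) (range 0 (suc m)) ⟩
  convolution (atOne (countCycles (statL k) 1)) (countCycles (statM k)) m +
  convolution (offOne (countCycles (statE k))) (countCycles (statL k)) m ∎
  where
  open ≡-Reasoning
  n : ℕ
  n = 2 + m
  split : ∀ a → countCycles (statMˡ k a) a * countCycles (statMʳ k a) (n ∸ a) ≡
                atOne (countCycles (statL k) 1) a * countCycles (statM k) (n ∸ a) +
                offOne (countCycles (statE k)) a * countCycles (statL k) (n ∸ a)
  split a with a ≡ᵇ 1 in e
  ... | true rewrite ≡ᵇ⇒≡-true {a} e = sym (+-identityʳ _)
  ... | false = refl

-- Formal power series

sumBelow : ℕ → (ℕ → ℤ) → ℤ
sumBelow zero g = + 0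
sumBelow (suc n) g = g 0 ℤ.+ sumBelow n (g ∘ suc)

⊛-sumBelow : ∀ X Y n → (X ⊛ Y) n ≡ sumBelow (suc n) (λ i → X i ℤ.* Y (n ∸ i))
⊛-sumBelow X Y n = foldr-applyUpTo (λ i → X i ℤ.* Y (n ∸ i)) (λ i → i) (suc n)
  where
  foldr-applyUpTo : ∀ (g : ℕ → ℤ) f n → foldr ℤ._+_ (+ 0) (map g (applyUpTo f n)) ≡ sumBelow n (g ∘ f)
  foldr-applyUpTo g f zero = refl
  foldr-applyUpTo g f (suc n) = cong (ℤ._+_ (g (f 0))) (foldr-applyUpTo g (f ∘ suc) n)

sumBelow-cong : ∀ n {g h} → (∀ {i} → i < n → g i ≡ h i) → sumBelow n g ≡ sumBelow n h
sumBelow-cong zero _ = refl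
sumBelow-cong (suc n) g≗h = cong₂ ℤ._+_ (g≗h (s≤s z≤n)) (sumBelow-cong n (g≗h ∘ s≤s))

sumBelow-zero : ∀ n {g} → (∀ {i} → i < n → g i ≡ + 0) → sumBelow n g ≡ + 0
sumBelow-zero zero _ = refl
sumBelow-zero (suc n) g≗0 rewrite g≗0 (s≤s z≤n) | sumBelow-zero n (g≗0 ∘ s≤s) = refl

sumBelow-+ : ∀ n g h → sumBelow n (λ i → g i ℤ.+ h i) ≡ sumBelow n g ℤ.+ sumBelow n h
sumBelow-+ zero g h = refl
sumBelow-+ (suc n) g h rewrite sumBelow-+ n (g ∘ suc) (h ∘ suc) = interchange (g 0) (h 0) _ _
  where
  interchange : ∀ a b c d → (a ℤ.+ b) ℤ.+ (c ℤ.+ d) ≡ (a ℤ.+ c) ℤ.+ (b ℤ.+ d)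
  interchange = solve-∀

sumBelow-- : ∀ n g h → sumBelow n (λ i → g i - h i) ≡ sumBelow n g - sumBelow n h
sumBelow-- zero g h = refl
sumBelow-- (suc n) g h rewrite sumBelow-- n (g ∘ suc) (h ∘ suc) = interchange (g 0) (h 0) _ _
  where
  interchange : ∀ a b c d → (a - b) ℤ.+ (c - d) ≡ (a ℤ.+ c) - (b ℤ.+ d)
  interchange = solve-∀

sumBelow-last : ∀ n g → sumBelow (suc n) g ≡ sumBelow n g ℤ.+ g n
sumBelow-last zero g = trans (ℤP.+-identityʳ (g 0)) (sym (ℤP.+-identityˡ (g 0)))
sumBelow-last (suc n) g = trans (cong (ℤ._+_ (g 0)) (sumBelow-last n (g ∘ suc))) (sym (ℤP.+-assoc (g 0) _ _))

sumBelow-reverse : ∀ n g → sumBelow n g ≡ sumBelow n (λ i → g (n ∸ suc i))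
sumBelow-reverse zero g = refl
sumBelow-reverse (suc n) g = begin
  g 0 ℤ.+ sumBelow n (g ∘ suc)                 ≡⟨ cong (ℤ._+_ (g 0)) (sumBelow-reverse n (g ∘ suc)) ⟩
  g 0 ℤ.+ sumBelow n (λ i → g (suc (n ∸ suc i))) ≡⟨ cong (ℤ._+_ (g 0)) (sumBelow-cong n (cong g ∘ suc-∸ n)) ⟩
  g 0 ℤ.+ sumBelow n (λ i → g (n ∸ i))         ≡⟨ ℤP.+-comm (g 0) _ ⟩
  sumBelow n (λ i → g (n ∸ i)) ℤ.+ g 0         ≡⟨ cong (λ j → sumBelow n (λ i → g (n ∸ i)) ℤ.+ g j) (n∸n≡0 n) ⟨
  sumBelow n (λ i → g (n ∸ i)) ℤ.+ g (n ∸ n)   ≡⟨ sumBelow-last n (λ i → g (n ∸ i)) ⟨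
  sumBelow (suc n) (λ i → g (suc n ∸ suc i))   ∎
  where
  open ≡-Reasoning
  suc-∸ : ∀ n {i} → i < n → suc (n ∸ suc i) ≡ n ∸ i
  suc-∸ n i< = sym (+-∸-assoc 1 i<)

≈-setoid : Setoid _ _
≈-setoid = record
  { Carrier = FPS
  ; _≈_ = _≈_
  ; isEquivalence = record { refl = λ _ → refl ; sym = λ e n → sym (e n) ; trans = λ e f n → trans (e n) (f n) }
  }

≈-sym : ∀ {X Y} → X ≈ Y → Y ≈ X
≈-sym e n = sym (e n)

⊕-cong : ∀ {X X′ Y Y′} → X ≈ X′ → Y ≈ Y′ → (X ⊕ Y) ≈ (X′ ⊕ Y′)
⊕-cong e f n = cong₂ ℤ._+_ (e n) (f n)

⊖-cong : ∀ {X X′ Y Y′} → X ≈ X′ → Y ≈ Y′ → (X ⊖ Y) ≈ (X′ ⊖ Y′)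
⊖-cong e f n = cong₂ _-_ (e n) (f n)

⊛-cong : ∀ {X X′ Y Y′} → X ≈ X′ → Y ≈ Y′ → (X ⊛ Y) ≈ (X′ ⊛ Y′)
⊛-cong {X} {X′} {Y} {Y′} e f n =
  trans (⊛-sumBelow X Y n) (trans (sumBelow-cong (suc n) λ {i} _ → cong₂ ℤ._*_ (e i) (f (n ∸ i))) (sym (⊛-sumBelow X′ Y′ n)))

⊕-congˡ : ∀ {X X′} Y → X ≈ X′ → (X ⊕ Y) ≈ (X′ ⊕ Y)
⊕-congˡ Y e = ⊕-cong e (λ _ → refl {x = Y _})

⊕-congʳ : ∀ X {Y Y′} → Y ≈ Y′ → (X ⊕ Y) ≈ (X ⊕ Y′)
⊕-congʳ X e = ⊕-cong (λ _ → refl {x = X _}) e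

⊛-congˡ : ∀ {X X′} Y → X ≈ X′ → (X ⊛ Y) ≈ (X′ ⊛ Y)
⊛-congˡ {X} {X′} Y e = ⊛-cong {X} {X′} {Y} {Y} e (λ _ → refl)

⊛-congʳ : ∀ X {Y Y′} → Y ≈ Y′ → (X ⊛ Y) ≈ (X ⊛ Y′)
⊛-congʳ X {Y} {Y′} e = ⊛-cong {X} {X} {Y} {Y′} (λ _ → refl) e

⊖-congˡ : ∀ {X X′} Y → X ≈ X′ → (X ⊖ Y) ≈ (X′ ⊖ Y)
⊖-congˡ Y e = ⊖-cong e (λ _ → refl {x = Y _})

⊖-congʳ : ∀ X {Y Y′} → Y ≈ Y′ → (X ⊖ Y) ≈ (X ⊖ Y′)
⊖-congʳ X e = ⊖-cong (λ _ → refl {x = X _}) e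

⊛-comm : ∀ X Y → (X ⊛ Y) ≈ (Y ⊛ X)
⊛-comm X Y n = begin
  (X ⊛ Y) n                                             ≡⟨ ⊛-sumBelow X Y n ⟩
  sumBelow (suc n) (λ i → X i ℤ.* Y (n ∸ i))              ≡⟨ sumBelow-reverse (suc n) (λ i → X i ℤ.* Y (n ∸ i)) ⟩
  sumBelow (suc n) (λ i → X (n ∸ i) ℤ.* Y (n ∸ (n ∸ i)))  ≡⟨ sumBelow-cong (suc n) swap ⟩
  sumBelow (suc n) (λ i → Y i ℤ.* X (n ∸ i))              ≡⟨ ⊛-sumBelow Y X n ⟨
  (Y ⊛ X) n                                             ∎
  where
  open ≡-Reasoning
  swap : ∀ {i} → i < suc n → X (n ∸ i) ℤ.* Y (n ∸ (n ∸ i)) ≡ Y i ℤ.* X (n ∸ i)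
  swap {i} i< = trans (cong (λ j → X (n ∸ i) ℤ.* Y j) (m∸[m∸n]≡n (≤-pred i<))) (ℤP.*-comm (X (n ∸ i)) (Y i))

⊛-distribʳ-⊕ : ∀ X Y W → ((X ⊕ Y) ⊛ W) ≈ ((X ⊛ W) ⊕ (Y ⊛ W))
⊛-distribʳ-⊕ X Y W n =
  trans (⊛-sumBelow (X ⊕ Y) W n)
    (trans (sumBelow-cong (suc n) λ {i} _ → ℤP.*-distribʳ-+ (W (n ∸ i)) (X i) (Y i))
      (trans (sumBelow-+ (suc n) (λ i → X i ℤ.* W (n ∸ i)) (λ i → Y i ℤ.* W (n ∸ i)))
        (sym (cong₂ ℤ._+_ (⊛-sumBelow X W n) (⊛-sumBelow Y W n)))))

⊛-distribʳ-⊖ : ∀ X Y W → ((X ⊖ Y) ⊛ W) ≈ ((X ⊛ W) ⊖ (Y ⊛ W))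
⊛-distribʳ-⊖ X Y W n =
  trans (⊛-sumBelow (X ⊖ Y) W n)
    (trans (sumBelow-cong (suc n) λ {i} _ → *-distribʳ-- (X i) (Y i) (W (n ∸ i)))
      (trans (sumBelow-- (suc n) (λ i → X i ℤ.* W (n ∸ i)) (λ i → Y i ℤ.* W (n ∸ i)))
        (sym (cong₂ _-_ (⊛-sumBelow X W n) (⊛-sumBelow Y W n)))))
  where
  *-distribʳ-- : ∀ a b c → (a - b) ℤ.* c ≡ a ℤ.* c - b ℤ.* c
  *-distribʳ-- = solve-∀

⊛-distribˡ-⊖ : ∀ X Y W → (X ⊛ (Y ⊖ W)) ≈ ((X ⊛ Y) ⊖ (X ⊛ W))
⊛-distribˡ-⊖ X Y W n =
  trans (⊛-comm X (Y ⊖ W) n) (trans (⊛-distribʳ-⊖ Y W X n) (⊖-cong (⊛-comm Y X) (⊛-comm W X) n))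

⊛-identityʳ : ∀ X → (X ⊛ 𝟙) ≈ X
⊛-identityʳ X n = begin
  (X ⊛ 𝟙) n                                                   ≡⟨ ⊛-sumBelow X 𝟙 n ⟩
  sumBelow (suc n) (λ i → X i ℤ.* 𝟙 (n ∸ i))                    ≡⟨ sumBelow-last n _ ⟩
  sumBelow n (λ i → X i ℤ.* 𝟙 (n ∸ i)) ℤ.+ X n ℤ.* 𝟙 (n ∸ n)
    ≡⟨ cong₂ ℤ._+_ (sumBelow-zero n λ {i} i< → trans (cong (ℤ._*_ (X i)) (𝟙-∸ i<)) (ℤP.*-zeroʳ (X i)))
                   (trans (cong (λ j → X n ℤ.* 𝟙 j) (n∸n≡0 n)) (ℤP.*-identityʳ (X n))) ⟩
  + 0 ℤ.+ X n                                                   ≡⟨ ℤP.+-identityˡ (X n) ⟩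
  X n                                                         ∎
  where
  open ≡-Reasoning
  𝟙-∸ : ∀ {n i} → i < n → 𝟙 (n ∸ i) ≡ + 0
  𝟙-∸ {suc n} {zero} _ = refl
  𝟙-∸ {suc n} {suc i} (s≤s i<) = 𝟙-∸ i<

⊛-zeroˡ : ∀ X → (𝟘 ⊛ X) ≈ 𝟘
⊛-zeroˡ X n = trans (⊛-sumBelow 𝟘 X n) (sumBelow-zero (suc n) λ {i} _ → ℤP.*-zeroˡ (X (n ∸ i)))

⊛-zeroʳ : ∀ X → (X ⊛ 𝟘) ≈ 𝟘
⊛-zeroʳ X n = trans (⊛-comm X 𝟘 n) (⊛-zeroˡ X n)

mono-zero : ∀ m → mono (+ 0) m ≈ 𝟘
mono-zero m n with m ≡ᵇ n
... | true = refl
... | false = refl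

mono₁-⊛-zero : ∀ c X → (mono c 1 ⊛ X) 0 ≡ + 0
mono₁-⊛-zero c X = ℤP.*-zeroˡ (X 0)

mono₁-⊛-suc : ∀ c X n → (mono c 1 ⊛ X) (suc n) ≡ c ℤ.* X n
mono₁-⊛-suc c X n = begin
  (mono c 1 ⊛ X) (suc n)                                    ≡⟨ ⊛-sumBelow (mono c 1) X (suc n) ⟩
  + 0 ℤ.* X (suc n) ℤ.+ (c ℤ.* X n ℤ.+ sumBelow n (λ i → + 0 ℤ.* X (n ∸ suc i)))
    ≡⟨ cong₂ ℤ._+_ (ℤP.*-zeroˡ (X (suc n)))
                   (cong (ℤ._+_ (c ℤ.* X n)) (sumBelow-zero n λ {i} _ → ℤP.*-zeroˡ (X (n ∸ suc i)))) ⟩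
  + 0 ℤ.+ (c ℤ.* X n ℤ.+ + 0)                                      ≡⟨ trans (ℤP.+-identityˡ _) (ℤP.+-identityʳ _) ⟩
  c ℤ.* X n                                                    ∎
  where open ≡-Reasoning

Z-⊛-suc : ∀ X n → (Z ⊛ X) (suc n) ≡ X n
Z-⊛-suc X n = trans (mono₁-⊛-suc (+ 1) X n) (ℤP.*-identityˡ (X n))

Z-⊛-assoc : ∀ X Y → ((Z ⊛ X) ⊛ Y) ≈ (Z ⊛ (X ⊛ Y))
Z-⊛-assoc X Y zero = trans (⊛-sumBelow (Z ⊛ X) Y 0) (cong (λ v → v ℤ.* Y 0 ℤ.+ + 0) (mono₁-⊛-zero (+ 1) X))
Z-⊛-assoc X Y (suc n) = begin
  ((Z ⊛ X) ⊛ Y) (suc n)                                       ≡⟨ ⊛-sumBelow (Z ⊛ X) Y (suc n) ⟩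
  (Z ⊛ X) 0 ℤ.* Y (suc n) ℤ.+ sumBelow (suc n) (λ i → (Z ⊛ X) (suc i) ℤ.* Y (n ∸ i))
    ≡⟨ cong₂ ℤ._+_ (cong (λ v → v ℤ.* Y (suc n)) (mono₁-⊛-zero (+ 1) X))
                   (sumBelow-cong (suc n) λ {i} _ → cong (λ v → v ℤ.* Y (n ∸ i)) (Z-⊛-suc X i)) ⟩
  + 0 ℤ.+ sumBelow (suc n) (λ i → X i ℤ.* Y (n ∸ i))              ≡⟨ ℤP.+-identityˡ _ ⟩
  sumBelow (suc n) (λ i → X i ℤ.* Y (n ∸ i))                    ≡⟨ ⊛-sumBelow X Y n ⟨
  (X ⊛ Y) n                                                   ≡⟨ Z-⊛-suc (X ⊛ Y) n ⟨
  (Z ⊛ (X ⊛ Y)) (suc n)                                       ∎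
  where open ≡-Reasoning

⊛-determined : ∀ {X Y M} → M 0 ≡ + 0 → ∀ n → (∀ {i} → i < n → X i ≡ Y i) → (X ⊛ M) n ≡ (Y ⊛ M) n
⊛-determined {X} {Y} {M} M₀≡0 n X≡Y = begin
  (X ⊛ M) n                                                  ≡⟨ trans (⊛-sumBelow X M n) (sumBelow-last n _) ⟩
  sumBelow n (λ i → X i ℤ.* M (n ∸ i)) ℤ.+ X n ℤ.* M (n ∸ n)
    ≡⟨ cong₂ ℤ._+_ (sumBelow-cong n λ {i} i< → cong (λ v → v ℤ.* M (n ∸ i)) (X≡Y i<)) (top X) ⟩
  sumBelow n (λ i → Y i ℤ.* M (n ∸ i)) ℤ.+ + 0
    ≡⟨ cong (ℤ._+_ (sumBelow n (λ i → Y i ℤ.* M (n ∸ i)))) (top Y) ⟨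
  sumBelow n (λ i → Y i ℤ.* M (n ∸ i)) ℤ.+ Y n ℤ.* M (n ∸ n)
    ≡⟨ trans (⊛-sumBelow Y M n) (sumBelow-last n _) ⟨
  (Y ⊛ M) n                                                  ∎
  where
  open ≡-Reasoning
  top : ∀ W → W n ℤ.* M (n ∸ n) ≡ + 0
  top W = trans (cong (λ j → W n ℤ.* M j) (n∸n≡0 n)) (trans (cong (ℤ._*_ (W n)) M₀≡0) (ℤP.*-zeroʳ (W n)))

fixedPoint-unique : ∀ {X Y} C M → M 0 ≡ + 0 → X ≈ (C ⊕ (X ⊛ M)) → Y ≈ (C ⊕ (Y ⊛ M)) → X ≈ Y
fixedPoint-unique {X} {Y} C M M₀≡0 X≈ Y≈ = <-rec (λ n → X n ≡ Y n) λ n X≡Y<n →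
  trans (X≈ n) (trans (cong (ℤ._+_ (C n)) (⊛-determined {X} {Y} {M} M₀≡0 n X≡Y<n)) (sym (Y≈ n)))

series : (ℕ → ℕ) → FPS
series c zero = + 0
series c (suc n) = + c (suc n)

series-⊛-zero : ∀ x Y → (series x ⊛ Y) 0 ≡ + 0
series-⊛-zero x Y = ℤP.*-zeroˡ (Y 0)

series-⊛-one : ∀ x y → (series x ⊛ series y) 1 ≡ + 0
series-⊛-one x y = cong₂ ℤ._+_ (ℤP.*-zeroˡ (series y 1)) (cong (ℤ._+ + 0) (ℤP.*-zeroʳ (series x 1)))

series-⊛-convolution : ∀ x y m → (series x ⊛ series y) (suc (suc m)) ≡ + convolution x y m
series-⊛-convolution x y m = begin
  (series x ⊛ series y) n
    ≡⟨ ⊛-sumBelow (series x) (series y) n ⟩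
  + 0 ℤ.* series y n ℤ.+ sumBelow (suc (suc m)) (g ∘ suc)
    ≡⟨ cong₂ ℤ._+_ (ℤP.*-zeroˡ (series y n)) (sumBelow-last (suc m) (g ∘ suc)) ⟩
  + 0 ℤ.+ (sumBelow (suc m) (g ∘ suc) ℤ.+ g (suc (suc m)))
    ≡⟨ trans (ℤP.+-identityˡ _) (cong (ℤ._+_ (sumBelow (suc m) (g ∘ suc))) last) ⟩
  sumBelow (suc m) (g ∘ suc) ℤ.+ + 0
    ≡⟨ ℤP.+-identityʳ _ ⟩
  sumBelow (suc m) (g ∘ suc)
    ≡⟨ sumBelow-cong (suc m) terms ⟩
  sumBelow (suc m) (λ i → + (x (suc i) * y (n ∸ suc i)))
    ≡⟨ sum-range (λ a → x a * y (n ∸ a)) 0 (suc m) ⟨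
  + convolution x y m ∎
  where
  open ≡-Reasoning
  n : ℕ
  n = suc (suc m)
  g : ℕ → ℤ
  g i = series x i ℤ.* series y (n ∸ i)
  last : g (suc (suc m)) ≡ + 0
  last = trans (cong (λ j → series x n ℤ.* series y j) (n∸n≡0 m)) (ℤP.*-zeroʳ (series x n))
  terms : ∀ {i} → i < suc m → g (suc i) ≡ + (x (suc i) * y (n ∸ suc i))
  terms {i} i< rewrite +-∸-assoc 1 (≤-pred i<) = sym (ℤP.pos-* (x (suc i)) (y (suc (m ∸ i))))
  sum-range : ∀ (h : ℕ → ℕ) s k → + sum (map h (range s k)) ≡ sumBelow k (λ i → + h (suc (s + i)))
  sum-range h s zero = refl
  sum-range h s (suc k) = trans (ℤP.pos-+ (h (suc s)) _)
    (cong₂ ℤ._+_ (cong (λ v → + h (suc v)) (sym (+-identityʳ s)))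
               (trans (sum-range h (suc s) k) (sumBelow-cong k λ {i} _ → cong (λ v → + h (suc v)) (sym (+-suc s i)))))

series-solves : ∀ c F → F 0 ≡ + 0 → F 1 ≡ + 0 → (∀ m → + c (suc (suc m)) ≡ F (suc (suc m))) →
                series c ≈ (mono (series c 1) 1 ⊕ F)
series-solves c F F₀ F₁ rec zero = sym (trans (ℤP.+-identityˡ (F 0)) F₀)
series-solves c F F₀ F₁ rec (suc zero) = sym (trans (cong (ℤ._+_ (series c 1)) F₁) (ℤP.+-identityʳ _))
series-solves c F F₀ F₁ rec (suc (suc m)) = trans (rec m) (sym (ℤP.+-identityˡ (F (suc (suc m)))))

series-recurrence : ∀ c x y → (∀ m → c (suc (suc m)) ≡ convolution x y m) →
                    series c ≈ (mono (series c 1) 1 ⊕ (series x ⊛ series y))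
series-recurrence c x y rec =
  series-solves c _ (series-⊛-zero x (series y)) (series-⊛-one x y)
    λ m → trans (cong +_ (rec m)) (sym (series-⊛-convolution x y m))

series-recurrence₂ : ∀ c x y x′ y′ → (∀ m → c (suc (suc m)) ≡ convolution x y m + convolution x′ y′ m) →
                     series c ≈ (mono (series c 1) 1 ⊕ ((series x ⊛ series y) ⊕ (series x′ ⊛ series y′)))
series-recurrence₂ c x y x′ y′ rec =
  series-solves c _ (cong₂ ℤ._+_ (series-⊛-zero x (series y)) (series-⊛-zero x′ (series y′)))
                    (cong₂ ℤ._+_ (series-⊛-one x y) (series-⊛-one x′ y′))
    λ m → trans (cong +_ (rec m)) (trans (ℤP.pos-+ (convolution x y m) _)
                                         (sym (cong₂ ℤ._+_ (series-⊛-convolution x y m) (series-⊛-convolution x′ y′ m))))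

ℒ 𝒟 ℳ ℰ : ℕ → FPS
ℒ k = series (countCycles (statL k))
𝒟 k = series (countCycles (statD k))
ℳ k = series (countCycles (statM k))
ℰ k = series (countCycles (statE k))

indicator : Bool → ℤ
indicator b = if b then + 1 else + 0

avoidsδ-Decreasing : ∀ k {s} → Decreasing s → avoidsδ k s ≡ (length s <ᵇ k)
avoidsδ-Decreasing k {s} d with ≤-<-connex k (length s)
... | inj₁ k≤ = trans (HasDecreasing⇒¬avoidsδ (HasDecreasing-≤ k≤ ⟨ s , ⊆-refl , refl , d ⟩))
                     (sym (≮⇒<ᵇ-false (≤⇒≯ k≤)))
... | inj₂ s<k = trans (¬HasDecreasing⇒avoidsδ (<⇒≱ s<k ∘ HasDecreasing⇒≤length)) (sym (<⇒<ᵇ-true s<k))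

series-at-one : ∀ p → series (countCycles p) 1 ≡ indicator (p [ 1 ])
series-at-one p with p [ 1 ]
... | true = refl
... | false = refl

private
  decreasing-21 : Decreasing (2 ∷ 1 ∷ [])
  decreasing-21 = (s≤s (s≤s z≤n) ∷ []) ∷ [] ∷ []

ℒ-one : ∀ k → ℒ k 1 ≡ indicator (1 <ᵇ k)
ℒ-one k = trans (series-at-one (statL k)) (cong indicator (avoidsδ-Decreasing k ([] ∷ [])))

𝒟-one : ∀ k → 𝒟 k 1 ≡ indicator (2 <ᵇ k)
𝒟-one k = trans (series-at-one (statD k)) (cong indicator (avoidsδ-Decreasing k decreasing-21))

ℰ-one : ∀ k → ℰ k 1 ≡ indicator (2 <ᵇ k)
ℰ-one k = trans (series-at-one (statE k)) (cong indicator (avoidsδ-Decreasing k decreasing-21))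

ℳ-one : ∀ k → ℳ k 1 ≡ indicator (0 <ᵇ k)
ℳ-one k = trans (series-at-one (statM k)) (cong indicator (avoidsδ-Decreasing k []))

mono-cong : ∀ {c c′} m → c ≡ c′ → mono c m ≈ mono c′ m
mono-cong m refl _ = refl

ℒ-equation : ∀ k → ℒ k ≈ (mono (indicator (1 <ᵇ k)) 1 ⊕ (𝒟 k ⊛ ℒ k))
ℒ-equation k n = trans (series-recurrence _ (countCycles (statD k)) (countCycles (statL k)) (recurrence-L k) n)
                       (⊕-congˡ (𝒟 k ⊛ ℒ k) (mono-cong 1 (ℒ-one k)) n)

𝒟-equation : ∀ k → 𝒟 k ≈ (mono (indicator (2 <ᵇ k)) 1 ⊕ (𝒟 k ⊛ ℳ (k ∸ 2)))
𝒟-equation k n = trans (series-recurrence _ (countCycles (statD k)) (countCycles (statM (k ∸ 2))) (recurrence-D k) n)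
                       (⊕-congˡ (𝒟 k ⊛ ℳ (k ∸ 2)) (mono-cong 1 (𝒟-one k)) n)

ℰ-equation : ∀ k → ℰ k ≈ (mono (indicator (2 <ᵇ k)) 1 ⊕ (ℰ k ⊛ ℳ (k ∸ 2)))
ℰ-equation k n = trans (series-recurrence _ (countCycles (statE k)) (countCycles (statM (k ∸ 2))) (recurrence-E k) n)
                       (⊕-congˡ (ℰ k ⊛ ℳ (k ∸ 2)) (mono-cong 1 (ℰ-one k)) n)

ℳ-equation : ∀ k → ℳ k ≈ (mono (indicator (0 <ᵇ k)) 1 ⊕
                           ((mono (indicator (1 <ᵇ k)) 1 ⊛ ℳ k) ⊕ ((ℰ k ⊖ mono (indicator (2 <ᵇ k)) 1) ⊛ ℒ k)))
ℳ-equation k n =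
  trans (series-recurrence₂ _ (atOne (countCycles (statL k) 1)) (countCycles (statM k))
                              (offOne (countCycles (statE k))) (countCycles (statL k)) (recurrence-M k) n)
        (⊕-cong (mono-cong 1 (ℳ-one k)) (⊕-cong (⊛-congˡ (ℳ k) atOne-series) (⊛-congˡ (ℒ k) offOne-series)) n)
  where
  atOne-series : series (atOne (countCycles (statL k) 1)) ≈ mono (indicator (1 <ᵇ k)) 1
  atOne-series zero = refl
  atOne-series (suc zero) = ℒ-one k
  atOne-series (suc (suc m)) = refl
  offOne-series : series (offOne (countCycles (statE k))) ≈ (ℰ k ⊖ mono (indicator (2 <ᵇ k)) 1)
  offOne-series zero = refl
  offOne-series (suc zero) = sym (trans (cong (ℰ k 1 -_) (sym (ℰ-one k))) (ℤP.+-inverseʳ (ℰ k 1)))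
  offOne-series (suc (suc m)) = sym (ℤP.+-identityʳ (ℰ k (suc (suc m))))

f≈ℒ : ∀ k → f k ≈ ℒ k
f≈ℒ k zero = refl
f≈ℒ k (suc n) = cong +_ (a≡count n k)

open import Relation.Binary.Reasoning.Setoid ≈-setoid

-- Solving the system

vanishes : ∀ {X} M → M 0 ≡ + 0 → X ≈ (mono (+ 0) 1 ⊕ (X ⊛ M)) → X ≈ 𝟘
vanishes M M₀≡0 X≈ = fixedPoint-unique (mono (+ 0) 1) M M₀≡0 X≈ 𝟘≈
  where
  𝟘≈ : 𝟘 ≈ (mono (+ 0) 1 ⊕ (𝟘 ⊛ M))
  𝟘≈ n = sym (cong₂ ℤ._+_ (mono-zero 1 n) (⊛-zeroˡ M n))

𝒟₁≈𝟘 : 𝒟 1 ≈ 𝟘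
𝒟₁≈𝟘 = vanishes (ℳ 0) refl (𝒟-equation 1)

𝒟₂≈𝟘 : 𝒟 2 ≈ 𝟘
𝒟₂≈𝟘 = vanishes (ℳ 0) refl (𝒟-equation 2)

ℰ₂≈𝟘 : ℰ 2 ≈ 𝟘
ℰ₂≈𝟘 = vanishes (ℳ 0) refl (ℰ-equation 2)

ℒ₁≈𝟘 : ℒ 1 ≈ 𝟘
ℒ₁≈𝟘 = begin
  ℒ 1                            ≈⟨ ℒ-equation 1 ⟩
  mono (+ 0) 1 ⊕ (𝒟 1 ⊛ ℒ 1)     ≈⟨ ⊕-cong (mono-zero 1) (⊛-congˡ (ℒ 1) 𝒟₁≈𝟘) ⟩
  𝟘 ⊕ (𝟘 ⊛ ℒ 1)                  ≈⟨ ⊕-congʳ 𝟘 (⊛-zeroˡ (ℒ 1)) ⟩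
  𝟘 ⊕ 𝟘                          ≈⟨ (λ _ → refl) ⟩
  𝟘                              ∎

ℒ₂≈Z : ℒ 2 ≈ Z
ℒ₂≈Z = begin
  ℒ 2                 ≈⟨ ℒ-equation 2 ⟩
  Z ⊕ (𝒟 2 ⊛ ℒ 2)     ≈⟨ ⊕-congʳ Z (⊛-congˡ (ℒ 2) 𝒟₂≈𝟘) ⟩
  Z ⊕ (𝟘 ⊛ ℒ 2)       ≈⟨ ⊕-congʳ Z (⊛-zeroˡ (ℒ 2)) ⟩
  Z ⊕ 𝟘               ≈⟨ (λ n → ℤP.+-identityʳ (Z n)) ⟩
  Z                   ∎

ℳ₁≈Z : ℳ 1 ≈ Z
ℳ₁≈Z = begin
  ℳ 1
    ≈⟨ ℳ-equation 1 ⟩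
  Z ⊕ ((mono (+ 0) 1 ⊛ ℳ 1) ⊕ ((ℰ 1 ⊖ mono (+ 0) 1) ⊛ ℒ 1))
    ≈⟨ ⊕-congʳ Z (⊕-cong (⊛-congˡ (ℳ 1) (mono-zero 1)) (⊛-congʳ (ℰ 1 ⊖ mono (+ 0) 1) ℒ₁≈𝟘)) ⟩
  Z ⊕ ((𝟘 ⊛ ℳ 1) ⊕ ((ℰ 1 ⊖ mono (+ 0) 1) ⊛ 𝟘))
    ≈⟨ ⊕-congʳ Z (⊕-cong (⊛-zeroˡ (ℳ 1)) (⊛-zeroʳ (ℰ 1 ⊖ mono (+ 0) 1))) ⟩
  Z ⊕ (𝟘 ⊕ 𝟘)
    ≈⟨ (λ n → ℤP.+-identityʳ (Z n)) ⟩
  Z ∎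

ℳ₂-equation : ℳ 2 ≈ (Z ⊕ (ℳ 2 ⊛ Z))
ℳ₂-equation = begin
  ℳ 2
    ≈⟨ ℳ-equation 2 ⟩
  Z ⊕ ((Z ⊛ ℳ 2) ⊕ ((ℰ 2 ⊖ mono (+ 0) 1) ⊛ ℒ 2))
    ≈⟨ ⊕-congʳ Z (⊕-cong (⊛-comm Z (ℳ 2)) (⊛-congˡ (ℒ 2) (⊖-cong ℰ₂≈𝟘 (mono-zero 1)))) ⟩
  Z ⊕ ((ℳ 2 ⊛ Z) ⊕ ((𝟘 ⊖ 𝟘) ⊛ ℒ 2))
    ≈⟨ ⊕-congʳ Z (⊕-congʳ (ℳ 2 ⊛ Z) (⊛-zeroˡ (ℒ 2))) ⟩
  Z ⊕ ((ℳ 2 ⊛ Z) ⊕ 𝟘)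
    ≈⟨ ⊕-congʳ Z (λ n → ℤP.+-identityʳ ((ℳ 2 ⊛ Z) n)) ⟩
  Z ⊕ (ℳ 2 ⊛ Z) ∎

𝒟₃-equation : 𝒟 3 ≈ (Z ⊕ (𝒟 3 ⊛ Z))
𝒟₃-equation n = trans (𝒟-equation 3 n) (⊕-congʳ Z (⊛-congʳ (𝒟 3) ℳ₁≈Z) n)

𝒟₃≈ℳ₂ : 𝒟 3 ≈ ℳ 2
𝒟₃≈ℳ₂ = fixedPoint-unique Z Z refl 𝒟₃-equation ℳ₂-equation

module AtLeastThree (j : ℕ) where

  k : ℕ
  k = 3 + j

  ℰ≈𝒟 : ℰ k ≈ 𝒟 k
  ℰ≈𝒟 = fixedPoint-unique Z (ℳ (k ∸ 2)) refl (ℰ-equation k) (𝒟-equation k)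

  -- both are the fixed point of X = z + (𝒟 − z) ℒ + X z
  ℳ≈ℒ : ℳ k ≈ ℒ k
  ℳ≈ℒ = fixedPoint-unique C Z refl ℳ≈ ℒ≈
    where
    C : FPS
    C = Z ⊕ ((𝒟 k ⊖ Z) ⊛ ℒ k)
    ℳ≈ : ℳ k ≈ (C ⊕ (ℳ k ⊛ Z))
    ℳ≈ n = trans (ℳ-equation k n)
      (trans (cong₂ (λ u v → Z n ℤ.+ (u ℤ.+ v)) (⊛-comm Z (ℳ k) n) (⊛-congˡ (ℒ k) (⊖-congˡ Z ℰ≈𝒟) n))
             (rearrange (Z n) ((ℳ k ⊛ Z) n) (((𝒟 k ⊖ Z) ⊛ ℒ k) n)))
      where
      rearrange : ∀ a b c → a ℤ.+ (b ℤ.+ c) ≡ a ℤ.+ c ℤ.+ b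
      rearrange = solve-∀
    ℒ≈ : ℒ k ≈ (C ⊕ (ℒ k ⊛ Z))
    ℒ≈ n = trans (ℒ-equation k n)
      (sym (trans (cong (λ v → Z n ℤ.+ v ℤ.+ (ℒ k ⊛ Z) n)
                        (trans (⊛-distribʳ-⊖ (𝒟 k) Z (ℒ k) n) (cong ((𝒟 k ⊛ ℒ k) n -_) (⊛-comm Z (ℒ k) n))))
                  (rearrange (Z n) ((𝒟 k ⊛ ℒ k) n) ((ℒ k ⊛ Z) n))))
      where
      rearrange : ∀ a b c → a ℤ.+ (b - c) ℤ.+ c ≡ a ℤ.+ b
      rearrange = solve-∀

𝒟≈ℳ-pred : ∀ j → 𝒟 (3 + j) ≈ ℳ (2 + j)
𝒟≈ℳ-pred zero = 𝒟₃≈ℳ₂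
𝒟≈ℳ-pred (suc j) = begin
  𝒟 (4 + j)   ≈⟨ fixedPoint-unique Z (ℳ (2 + j)) refl (𝒟-equation (4 + j)) ℒ≈ ⟩
  ℒ (3 + j)   ≈⟨ ≈-sym (AtLeastThree.ℳ≈ℒ j) ⟩
  ℳ (3 + j)   ∎
  where
  ℒ≈ : ℒ (3 + j) ≈ (Z ⊕ (ℒ (3 + j) ⊛ ℳ (2 + j)))
  ℒ≈ = begin
    ℒ (3 + j)                          ≈⟨ ℒ-equation (3 + j) ⟩
    Z ⊕ (𝒟 (3 + j) ⊛ ℒ (3 + j))        ≈⟨ ⊕-congʳ Z (⊛-congˡ (ℒ (3 + j)) (𝒟≈ℳ-pred j)) ⟩
    Z ⊕ (ℳ (2 + j) ⊛ ℒ (3 + j))        ≈⟨ ⊕-congʳ Z (⊛-comm (ℳ (2 + j)) (ℒ (3 + j))) ⟩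
    Z ⊕ (ℒ (3 + j) ⊛ ℳ (2 + j))        ∎

ℒ-recursion : ∀ j → (ℒ (4 + j) ⊛ (𝟙 ⊖ ℒ (3 + j))) ≈ Z
ℒ-recursion j = begin
  ℒ k ⊛ (𝟙 ⊖ ℒ (k ∸ 1))                ≈⟨ ⊛-distribˡ-⊖ (ℒ k) 𝟙 (ℒ (k ∸ 1)) ⟩
  (ℒ k ⊛ 𝟙) ⊖ (ℒ k ⊛ ℒ (k ∸ 1))        ≈⟨ ⊖-congˡ (ℒ k ⊛ ℒ (k ∸ 1)) (⊛-identityʳ (ℒ k)) ⟩
  ℒ k ⊖ (ℒ k ⊛ ℒ (k ∸ 1))              ≈⟨ ⊖-congˡ (ℒ k ⊛ ℒ (k ∸ 1)) ℒ≈ ⟩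
  (Z ⊕ (ℒ k ⊛ ℒ (k ∸ 1))) ⊖ (ℒ k ⊛ ℒ (k ∸ 1))
                                       ≈⟨ (λ n → cancel (Z n) ((ℒ k ⊛ ℒ (k ∸ 1)) n)) ⟩
  Z                                    ∎
  where
  k : ℕ
  k = 4 + j
  cancel : ∀ a b → a ℤ.+ b - b ≡ a
  cancel = solve-∀
  ℒ≈ : ℒ k ≈ (Z ⊕ (ℒ k ⊛ ℒ (k ∸ 1)))
  ℒ≈ = begin
    ℒ k                        ≈⟨ ℒ-equation k ⟩
    Z ⊕ (𝒟 k ⊛ ℒ k)            ≈⟨ ⊕-congʳ Z (⊛-congˡ (ℒ k) (𝒟≈ℳ-pred (suc j))) ⟩
    Z ⊕ (ℳ (k ∸ 1) ⊛ ℒ k)      ≈⟨ ⊕-congʳ Z (⊛-congˡ (ℒ k) (AtLeastThree.ℳ≈ℒ j)) ⟩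
    Z ⊕ (ℒ (k ∸ 1) ⊛ ℒ k)      ≈⟨ ⊕-congʳ Z (⊛-comm (ℒ (k ∸ 1)) (ℒ k)) ⟩
    Z ⊕ (ℒ k ⊛ ℒ (k ∸ 1))      ∎

ℒ₃-equation : (ℒ 3 ⊛ (𝟙 ⊖ mono (+ 2) 1)) ≈ (Z ⊛ (𝟙 ⊖ Z))
ℒ₃-equation = begin
  ℒ 3 ⊛ (𝟙 ⊖ mono (+ 2) 1)            ≈⟨ ⊛-distribˡ-⊖ (ℒ 3) 𝟙 (mono (+ 2) 1) ⟩
  (ℒ 3 ⊛ 𝟙) ⊖ (ℒ 3 ⊛ mono (+ 2) 1)    ≈⟨ ⊖-cong (⊛-identityʳ (ℒ 3)) (⊛-comm (ℒ 3) (mono (+ 2) 1)) ⟩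
  ℒ 3 ⊖ (mono (+ 2) 1 ⊛ ℒ 3)          ≈⟨ coefficients ⟩
  Z ⊛ (𝟙 ⊖ Z)                         ∎
  where
  𝒟₃≈ : 𝒟 3 ≈ (Z ⊕ (Z ⊛ 𝒟 3))
  𝒟₃≈ = begin
    𝒟 3                ≈⟨ 𝒟₃-equation ⟩
    Z ⊕ (𝒟 3 ⊛ Z)      ≈⟨ ⊕-congʳ Z (⊛-comm (𝒟 3) Z) ⟩
    Z ⊕ (Z ⊛ 𝒟 3)      ∎
  𝒟ℒ≈ : (𝒟 3 ⊛ ℒ 3) ≈ (ℒ 3 ⊖ Z)
  𝒟ℒ≈ n = sym (trans (cong (_- Z n) (ℒ-equation 3 n)) (cancel (Z n) ((𝒟 3 ⊛ ℒ 3) n)))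
    where
    cancel : ∀ a b → a ℤ.+ b - a ≡ b
    cancel = solve-∀
  -- ℒ = z + 𝒟 ℒ with 𝒟 = z + z 𝒟 gives ℒ = z + z ℒ + z (ℒ − z)
  ℒ₃≈ : ℒ 3 ≈ (Z ⊕ ((Z ⊛ ℒ 3) ⊕ (Z ⊛ (ℒ 3 ⊖ Z))))
  ℒ₃≈ = begin
    ℒ 3                                      ≈⟨ ℒ-equation 3 ⟩
    Z ⊕ (𝒟 3 ⊛ ℒ 3)                          ≈⟨ ⊕-congʳ Z (⊛-congˡ (ℒ 3) 𝒟₃≈) ⟩
    Z ⊕ ((Z ⊕ (Z ⊛ 𝒟 3)) ⊛ ℒ 3)              ≈⟨ ⊕-congʳ Z (⊛-distribʳ-⊕ Z (Z ⊛ 𝒟 3) (ℒ 3)) ⟩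
    Z ⊕ ((Z ⊛ ℒ 3) ⊕ ((Z ⊛ 𝒟 3) ⊛ ℒ 3))      ≈⟨ ⊕-congʳ Z (⊕-congʳ (Z ⊛ ℒ 3) (Z-⊛-assoc (𝒟 3) (ℒ 3))) ⟩
    Z ⊕ ((Z ⊛ ℒ 3) ⊕ (Z ⊛ (𝒟 3 ⊛ ℒ 3)))      ≈⟨ ⊕-congʳ Z (⊕-congʳ (Z ⊛ ℒ 3) (⊛-congʳ Z 𝒟ℒ≈)) ⟩
    Z ⊕ ((Z ⊛ ℒ 3) ⊕ (Z ⊛ (ℒ 3 ⊖ Z)))        ∎
  coefficients : (ℒ 3 ⊖ (mono (+ 2) 1 ⊛ ℒ 3)) ≈ (Z ⊛ (𝟙 ⊖ Z))
  coefficients zero = trans (cong (_-_ (+ 0)) (mono₁-⊛-zero (+ 2) (ℒ 3))) (sym (mono₁-⊛-zero (+ 1) (𝟙 ⊖ Z)))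
  coefficients (suc n) =
    trans (cong₂ _-_ (trans (ℒ₃≈ (suc n))
                            (cong (ℤ._+_ (Z (suc n))) (cong₂ ℤ._+_ (Z-⊛-suc (ℒ 3) n) (Z-⊛-suc (ℒ 3 ⊖ Z) n))))
                     (mono₁-⊛-suc (+ 2) (ℒ 3) n))
          (trans (simplify (Z (suc n)) (ℒ 3 n) (Z n)) (sym (Z-⊛-suc (𝟙 ⊖ Z) n)))
    where
    simplify : ∀ z₁ l z₀ → z₁ ℤ.+ (l ℤ.+ (l - z₀)) - + 2 ℤ.* l ≡ z₁ - z₀
    simplify = solve-∀

corollary2p8 : ((k : ℕ) → 4 ≤ k → (f k ⊛ (𝟙 ⊖ f (k ∸ 1))) ≈ Z)
    × (f 1 ≈ 𝟘)
    × (f 2 ≈ Z)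
    × ((f 3 ⊛ (𝟙 ⊖ mono (+ 2) 1)) ≈ (Z ⊛ (𝟙 ⊖ Z)))
corollary2p8 = recursion , f₁ , f₂ , f₃
  where
  recursion : (k : ℕ) → 4 ≤ k → (f k ⊛ (𝟙 ⊖ f (k ∸ 1))) ≈ Z
  recursion k@(suc (suc (suc (suc j)))) (s≤s (s≤s (s≤s (s≤s _)))) = begin
    f k ⊛ (𝟙 ⊖ f (k ∸ 1))    ≈⟨ ⊛-cong (f≈ℒ k) (⊖-congʳ 𝟙 (f≈ℒ (k ∸ 1))) ⟩
    ℒ k ⊛ (𝟙 ⊖ ℒ (k ∸ 1))    ≈⟨ ℒ-recursion j ⟩
    Z                        ∎
  f₁ : f 1 ≈ 𝟘
  f₁ = begin f 1 ≈⟨ f≈ℒ 1 ⟩ ℒ 1 ≈⟨ ℒ₁≈𝟘 ⟩ 𝟘 ∎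
  f₂ : f 2 ≈ Z
  f₂ = begin f 2 ≈⟨ f≈ℒ 2 ⟩ ℒ 2 ≈⟨ ℒ₂≈Z ⟩ Z ∎
  f₃ : (f 3 ⊛ (𝟙 ⊖ mono (+ 2) 1)) ≈ (Z ⊛ (𝟙 ⊖ Z))
  f₃ = begin
    f 3 ⊛ (𝟙 ⊖ mono (+ 2) 1)    ≈⟨ ⊛-congˡ (𝟙 ⊖ mono (+ 2) 1) (f≈ℒ 3) ⟩
    ℒ 3 ⊛ (𝟙 ⊖ mono (+ 2) 1)    ≈⟨ ℒ₃-equation ⟩
    Z ⊛ (𝟙 ⊖ Z)                 ∎
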